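{- Let $d_1,d_2$ be nonzero integers and $f$ a positive integer. Let $\mathcal{X}_{d_2}$ be a complete set of representatives of the reduced residue classes modulo $d_2$, and $\mathcal{Y}_{d_1}$ a complete set of representatives of the reduced residue classes modulo $d_1$, all of whose elements are coprime to $d_1d_2f$. Let $\mathcal{F}_f=\{(x_3,y_3)\in\{f+1,\dots,2f\}^2: x_3y_3\equiv1\pmod f\}$ and $\mathcal{K}_f=\{0,1,\dots,f-1\}$. For each $x_2\in\mathcal X_{d_2}$, $y_1\in\mathcal Y_{d_1}$ fix integers $\overline{x_2},\overline{y_1}$ with $x_2\overline{x_2}\equiv1\pmod{d_2}$ and $y_1\overline{y_1}\equiv1\pmod{d_1}$. Then the map sending $(x_2,y_1,(x_3,y_3),k)\in\mathcal X_{d_2}\times\mathcal Y_{d_1}\times\mathcal F_f\times\mathcal K_f$ to the double coset \[ \Gamma_\infty\begin{pmatrix} \frac{ux_2-d_1x_3}{d_2} & \frac{ux_2y_1-d_1x_3y_1-x_2d_2}{d_1d_2} & \frac{ -vx_2+ux_2y_3+d_1(1-x_3y_3)}{d_1d_2f}\\ u & \frac{uy_1-d_2}{d_1} & \frac{uy_3-v}{d_1f}\\ d_1f & fy_1 & y_3 \end{pmatrix}\Gamma_\infty, \] where $u=d_1x_3\overline{x_2}+d_2\overline{y_1}+d_1d_2k$ and $v=d_2\overline{y_1}y_3+d_1\overline{x_2}+d_1d_2y_3k$, is a bijection onto $\Gamma_\infty\backslash\Omega(d_1,d_2,f)/\Gamma_\infty$.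
   Context: $\Gamma_\infty=U_3(\mathbb{Z})$ is the group of integral $3\times3$ upper triangular unipotent matrices. $\Omega(d_1,d_2,f)=\{A\in\mathrm{SL}_3(\mathbb{Z}):\gcd(A_{31},A_{32})=f,\ A_{31}=d_1f,\ A_{21}A_{32}-A_{22}A_{31}=d_2f\}$, which is invariant under left and right multiplication by $\Gamma_\infty$. -}

module Defs where

open import Data.Integer using (ℤ; +_; _+_; _-_; _*_; -_; _≤_; _<_; 0ℤ; 1ℤ)
open import Data.Integer.Divisibility using (_∣_)
open import Data.Integer.Coprimality using (Coprime)
open import Data.Integer.GCD using (gcd)
open import Data.Fin using (Fin; zero; suc)
open import Data.Product using (Σ; ∃; _×_; _,_)
open import Relation.Binary.PropositionalEquality using (_≡_)

-- 3×3 integer matrices, indices 0,1,2 (so A₃₁ is  A 2 0  etc.)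
Mat3 : Set
Mat3 = Fin 3 → Fin 3 → ℤ

pattern i0 = zero
pattern i1 = suc zero
pattern i2 = suc (suc zero)

_≋_ : Mat3 → Mat3 → Set
A ≋ B = ∀ i j → A i j ≡ B i j

_⊗_ : Mat3 → Mat3 → Mat3
(A ⊗ B) i j = A i i0 * B i0 j + A i i1 * B i1 j + A i i2 * B i2 j

det3 : Mat3 → ℤ
det3 A =
    A i0 i0 * (A i1 i1 * A i2 i2 - A i1 i2 * A i2 i1)
  - A i0 i1 * (A i1 i0 * A i2 i2 - A i1 i2 * A i2 i0)
  + A i0 i2 * (A i1 i0 * A i2 i1 - A i1 i1 * A i2 i0)

InSL3 : Mat3 → Set
InSL3 A = det3 A ≡ 1ℤ

-- the element of Γ∞ = U₃(ℤ) with superdiagonal entries a, c and corner b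
unip : ℤ → ℤ → ℤ → Mat3
unip a b c i0 i0 = 1ℤ
unip a b c i0 i1 = a
unip a b c i0 i2 = b
unip a b c i1 i0 = 0ℤ
unip a b c i1 i1 = 1ℤ
unip a b c i1 i2 = c
unip a b c i2 i0 = 0ℤ
unip a b c i2 i1 = 0ℤ
unip a b c i2 i2 = 1ℤ

SameDoubleCoset : Mat3 → Mat3 → Set
SameDoubleCoset A B =
  Σ ℤ λ a → Σ ℤ λ b → Σ ℤ λ c → Σ ℤ λ a' → Σ ℤ λ b' → Σ ℤ λ c' →
    B ≋ ((unip a b c ⊗ A) ⊗ unip a' b' c')

InΩ : ℤ → ℤ → ℤ → Mat3 → Set
InΩ d₁ d₂ f A =
  InSL3 A ×
  gcd (A i2 i0) (A i2 i1) ≡ f ×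
  A i2 i0 ≡ d₁ * f ×
  A i1 i0 * A i2 i1 - A i1 i1 * A i2 i0 ≡ d₂ * f

CompleteReducedReps : ℤ → ℤ → (ℤ → Set) → Set
CompleteReducedReps m N 𝒳 =
  (∀ x → 𝒳 x → Coprime x N) ×
  (∀ z → Coprime z m → ∃ λ x → 𝒳 x × m ∣ (z - x)) ×
  (∀ x x' → 𝒳 x → 𝒳 x' → m ∣ (x - x') → x ≡ x')

InF : ℤ → ℤ → ℤ → Set
InF f x₃ y₃ =
  (f + 1ℤ ≤ x₃ × x₃ ≤ f + f) × (f + 1ℤ ≤ y₃ × y₃ ≤ f + f) ×
  f ∣ (x₃ * y₃ - 1ℤ)

InK : ℤ → ℤ → Set
InK f k = 0ℤ ≤ k × k < f

Params : Set
Params = ℤ × ℤ × ℤ × ℤ × ℤ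

InDomain : ℤ → ℤ → ℤ → (ℤ → Set) → (ℤ → Set) → Params → Set
InDomain d₁ d₂ f 𝒳 𝒴 (x₂ , y₁ , x₃ , y₃ , k) =
  𝒳 x₂ × 𝒴 y₁ × InF f x₃ y₃ × InK f k

-- "M is the matrix of the statement attached to the parameters":
-- each entry with a denominator is characterised by (denominator)·entry = numerator,
-- so the existence of such an integer M encodes integrality of the entries.
IsImage : ℤ → ℤ → ℤ → (ℤ → ℤ) → (ℤ → ℤ) → Params → Mat3 → Set
IsImage d₁ d₂ f xbar ybar (x₂ , y₁ , x₃ , y₃ , k) M =
  let u = d₁ * x₃ * xbar x₂ + d₂ * ybar y₁ + d₁ * d₂ * k
      v = d₂ * ybar y₁ * y₃ + d₁ * xbar x₂ + d₁ * d₂ * y₃ * k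
  in
  d₂ * M i0 i0 ≡ u * x₂ - d₁ * x₃ ×
  d₁ * d₂ * M i0 i1 ≡ u * x₂ * y₁ - d₁ * x₃ * y₁ - x₂ * d₂ ×
  d₁ * d₂ * f * M i0 i2 ≡ - v * x₂ + u * x₂ * y₃ + d₁ * (1ℤ - x₃ * y₃) ×
  M i1 i0 ≡ u ×
  d₁ * M i1 i1 ≡ u * y₁ - d₂ ×
  d₁ * f * M i1 i2 ≡ u * y₃ - v ×
  M i2 i0 ≡ d₁ * f ×
  M i2 i1 ≡ f * y₁ ×
  M i2 i2 ≡ y₃

{-# OPTIONS --safe #-}
module Submission where

-- Left multiplication by Γ∞ adds multiples of lower rows to higher ones, right
-- multiplication adds multiples of earlier columns to later ones. For A ∈ Ω(d₁,d₂,f) the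
-- bottom row is (d₁f, fw, A₃₃) with w prime to d₁, and the double coset of A determines
-- y₁ ≡ w (mod d₁), y₃ ≡ A₃₃ (mod f), x₂ ≡ (A₁₁A₃₂ - A₁₂A₃₁)/f (mod d₂),
-- x₃ ≡ A₁₁A₂₂ - A₁₂A₂₁ (mod f) and, comparing second rows, k (mod f); this is injectivity.
-- Conversely, reading these residues off A and solving for k, Γ∞ × Γ∞ matches the first two
-- columns of A with those of the matrix attached to the parameters. Both matrices have
-- determinant 1, so by Cramer's rule their third columns then differ by a combination of
-- the first two, which is one more right Γ∞ move.

open import Defs
open import Data.Integer using (ℤ; +_; -[1+_]; _+_; _-_; _*_; -_; _≤_; _<_; ∣_∣; 0ℤ; 1ℤ; +≤+; +<+; -≤-)
open import Data.Integer.Properties using (i≡j⇒i-j≡0; i-j≡0⇒i≡j; *-cancelˡ-≡; +-injective; abs-*; pos-*; pos-+; +-mono-≤; neg-mono-≤; *-identityˡ; +-comm)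
open import Data.Integer.Base using (≢-nonZero)
open import Data.Integer.Divisibility using (_∣_)
import Data.Integer.Divisibility.Signed as Signed
open import Data.Integer.Coprimality using (Coprime; coprime-divisor)
import Data.Integer.Coprimality as Coprime
open import Data.Integer.GCD using (gcd; gcd[i,j]∣j)
open import Data.Integer.DivMod using (_%_; _/_; a≡a%n+[a/n]*n; n%d<d)
open import Data.Integer.Tactic.RingSolver using (solve; solve-∀)
open import Data.Fin using (Fin; suc)
open import Data.Nat as ℕ using (ℕ; zero; suc; s≤s; z≤n)
import Data.Nat.Properties as ℕ
import Data.Nat.Divisibility as ℕ
import Data.Nat.Coprimality as ℕ
import Data.Nat.GCD as ℕ
open import Data.Product using (∃; ∃₂; _×_; _,_; proj₁; proj₂)
open import Data.List using (_∷_; [])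
open import Data.Empty using (⊥-elim)
open import Relation.Binary.PropositionalEquality

linear-combination₁ : ∀ {P Q L₁ R₁ : ℤ} → L₁ ≡ R₁ → (c₁ : ℤ) →
  P ≡ Q + c₁ * (L₁ - R₁) → P ≡ Q
linear-combination₁ {P} {Q} h₁ c₁ e =
  trans e (trans (cong (λ x → Q + c₁ * x) (i≡j⇒i-j≡0 h₁)) (solve (Q ∷ c₁ ∷ [])))

linear-combination₂ : ∀ {P Q L₁ R₁ L₂ R₂ : ℤ} → L₁ ≡ R₁ → L₂ ≡ R₂ → (c₁ c₂ : ℤ) →
  P ≡ Q + c₁ * (L₁ - R₁) + c₂ * (L₂ - R₂) → P ≡ Q
linear-combination₂ {P} {Q} h₁ h₂ c₁ c₂ e =
  trans e (trans (cong₂ (λ x y → Q + c₁ * x + c₂ * y) (i≡j⇒i-j≡0 h₁) (i≡j⇒i-j≡0 h₂))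
                 (solve (Q ∷ c₁ ∷ c₂ ∷ [])))

linear-combination₃ : ∀ {P Q L₁ R₁ L₂ R₂ L₃ R₃ : ℤ} → L₁ ≡ R₁ → L₂ ≡ R₂ → L₃ ≡ R₃ →
  (c₁ c₂ c₃ : ℤ) →
  P ≡ Q + c₁ * (L₁ - R₁) + c₂ * (L₂ - R₂) + c₃ * (L₃ - R₃) → P ≡ Q
linear-combination₃ h₁ h₂ h₃ c₁ c₂ c₃ e =
  linear-combination₂ h₁ h₂ c₁ c₂ (linear-combination₁ h₃ c₃ e)

linear-combination₄ : ∀ {P Q L₁ R₁ L₂ R₂ L₃ R₃ L₄ R₄ : ℤ} →
  L₁ ≡ R₁ → L₂ ≡ R₂ → L₃ ≡ R₃ → L₄ ≡ R₄ → (c₁ c₂ c₃ c₄ : ℤ) →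
  P ≡ Q + c₁ * (L₁ - R₁) + c₂ * (L₂ - R₂) + c₃ * (L₃ - R₃) + c₄ * (L₄ - R₄) → P ≡ Q
linear-combination₄ h₁ h₂ h₃ h₄ c₁ c₂ c₃ c₄ e =
  linear-combination₃ h₁ h₂ h₃ c₁ c₂ c₃ (linear-combination₁ h₄ c₄ e)

linear-combination₅ : ∀ {P Q L₁ R₁ L₂ R₂ L₃ R₃ L₄ R₄ L₅ R₅ : ℤ} →
  L₁ ≡ R₁ → L₂ ≡ R₂ → L₃ ≡ R₃ → L₄ ≡ R₄ → L₅ ≡ R₅ → (c₁ c₂ c₃ c₄ c₅ : ℤ) →
  P ≡ Q + c₁ * (L₁ - R₁) + c₂ * (L₂ - R₂) + c₃ * (L₃ - R₃) + c₄ * (L₄ - R₄) + c₅ * (L₅ - R₅) →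
  P ≡ Q
linear-combination₅ h₁ h₂ h₃ h₄ h₅ c₁ c₂ c₃ c₄ c₅ e =
  linear-combination₄ h₁ h₂ h₃ h₄ c₁ c₂ c₃ c₄ (linear-combination₁ h₅ c₅ e)

*-cancelˡ-≢0 : ∀ c {x y : ℤ} → c ≢ 0ℤ → c * x ≡ c * y → x ≡ y
*-cancelˡ-≢0 c {x} {y} c≢0 = *-cancelˡ-≡ c x y {{≢-nonZero c≢0}}

∣⇒∃-quotient : ∀ {a b : ℤ} → a ∣ b → ∃ λ q → b ≡ q * a
∣⇒∃-quotient a∣b with Signed.∣ᵤ⇒∣ a∣b
... | Signed.divides q eq = q , eq

quotient⇒∣ : ∀ {a b : ℤ} q → b ≡ q * a → a ∣ b
quotient⇒∣ q eq = Signed.∣⇒∣ᵤ (Signed.divides q eq)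

≡⇒quotient≡0 : ∀ {x y q n : ℤ} → n ≢ 0ℤ → x ≡ y → x - y ≡ q * n → q ≡ 0ℤ
≡⇒quotient≡0 {x} {q = q} {n} n≢0 refl x-x≡qn =
  *-cancelˡ-≢0 n n≢0 (linear-combination₁ x-x≡qn (- 1ℤ) (solve (x ∷ q ∷ n ∷ [])))

-- Residues in a window

private
  bounded-multiple≡0 : ∀ m (q : ℤ) → q * + suc m ≤ + m → - (+ m) ≤ q * + suc m → q ≡ 0ℤ
  bounded-multiple≡0 m (+ zero)    _         _ = refl
  bounded-multiple≡0 m (+ suc n)   (+≤+ le)  _ =
    ⊥-elim (ℕ.<-irrefl refl (ℕ.≤-trans (s≤s (ℕ.m≤m+n m (n ℕ.* suc m))) le))
  bounded-multiple≡0 zero -[1+ n ] _ ()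
  bounded-multiple≡0 (suc m) -[1+ n ] _ (-≤- le) =
    ⊥-elim (ℕ.<-irrefl refl (ℕ.≤-trans (s≤s (ℕ.m≤m+n m (n ℕ.* suc (suc m)))) le))

congruent-in-window⇒≡ : ∀ m {lo a b q : ℤ} → lo ≤ a → a ≤ lo + + m → lo ≤ b → b ≤ lo + + m →
  a - b ≡ q * + suc m → a ≡ b
congruent-in-window⇒≡ m {lo} {a} {b} {q} lo≤a a≤hi lo≤b b≤hi a-b≡qn =
  i-j≡0⇒i≡j a b (trans a-b≡qn (cong (_* + suc m) q≡0))
  where
  up : ∀ (l x : ℤ) → (l + x) - l ≡ x
  up = solve-∀
  down : ∀ (l x : ℤ) → l - (l + x) ≡ - x
  down = solve-∀
  q≡0 : q ≡ 0ℤ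
  q≡0 = bounded-multiple≡0 m q
    (subst (_≤ + m) a-b≡qn (subst (a - b ≤_) (up lo (+ m)) (+-mono-≤ a≤hi (neg-mono-≤ lo≤b))))
    (subst (- (+ m) ≤_) a-b≡qn (subst (_≤ a - b) (down lo (+ m)) (+-mono-≤ lo≤a (neg-mono-≤ b≤hi))))

InUpperWindow : ℤ → ℤ → Set
InUpperWindow f a = f + 1ℤ ≤ a × a ≤ f + f

InK-congruent⇒≡ : ∀ m {a b q : ℤ} → InK (+ suc m) a → InK (+ suc m) b →
  a - b ≡ q * + suc m → a ≡ b
InK-congruent⇒≡ m {q = q} (0≤a , a<n) (0≤b , b<n) =
  congruent-in-window⇒≡ m {q = q} 0≤a (≤-pred 0≤a a<n) 0≤b (≤-pred 0≤b b<n)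
  where
  ≤-pred : ∀ {k} → 0ℤ ≤ k → k < + suc m → k ≤ 0ℤ + + m
  ≤-pred (+≤+ _) (+<+ (s≤s k≤m)) = +≤+ k≤m

InUpperWindow-congruent⇒≡ : ∀ m {a b q : ℤ} → InUpperWindow (+ suc m) a → InUpperWindow (+ suc m) b →
  a - b ≡ q * + suc m → a ≡ b
InUpperWindow-congruent⇒≡ m {a} {b} {q} (lo≤a , a≤hi) (lo≤b , b≤hi) =
  congruent-in-window⇒≡ m {q = q} lo≤a (subst (a ≤_) (top (+ m)) a≤hi) lo≤b (subst (b ≤_) (top (+ m)) b≤hi)
  where
  top : ∀ (x : ℤ) → (1ℤ + x) + (1ℤ + x) ≡ ((1ℤ + x) + 1ℤ) + x
  top = solve-∀

InK-residue : ∀ m (z : ℤ) → ∃ λ k → InK (+ suc m) k × ∃ λ q → z - k ≡ q * + suc m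
InK-residue m z =
  + (z % + suc m) , (+≤+ z≤n , +<+ (n%d<d z (+ suc m))) , z / + suc m ,
  move z (+ (z % + suc m)) (z / + suc m) (+ suc m) (a≡a%n+[a/n]*n z (+ suc m))
  where
  move : ∀ z r q n → z ≡ r + q * n → z - r ≡ q * n
  move z r q n e = linear-combination₁ e 1ℤ (solve (z ∷ r ∷ q ∷ n ∷ []))

InUpperWindow-residue : ∀ m (z : ℤ) → ∃ λ y → InUpperWindow (+ suc m) y × ∃ λ q → z - y ≡ q * + suc m
InUpperWindow-residue m z with InK-residue m (z - 1ℤ)
... | + k , (_ , +<+ (s≤s k≤m)) , q , z-1-k≡qn =
  + k + 1ℤ + + suc m , (+≤+ lower , +≤+ upper) , q - 1ℤ ,
  shift z (+ k) q (+ suc m) z-1-k≡qn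
  where
  shift : ∀ z k q n → (z - 1ℤ) - k ≡ q * n → z - (k + 1ℤ + n) ≡ (q - 1ℤ) * n
  shift z k q n e = linear-combination₁ e 1ℤ (solve (z ∷ k ∷ q ∷ n ∷ []))
  lower : suc m ℕ.+ 1 ℕ.≤ k ℕ.+ 1 ℕ.+ suc m
  lower = ℕ.≤-trans (ℕ.≤-reflexive (ℕ.+-comm (suc m) 1))
            (ℕ.≤-trans (ℕ.m≤n+m (1 ℕ.+ suc m) k) (ℕ.≤-reflexive (sym (ℕ.+-assoc k 1 (suc m)))))
  upper : k ℕ.+ 1 ℕ.+ suc m ℕ.≤ suc m ℕ.+ suc m
  upper = ℕ.+-monoˡ-≤ (suc m) (ℕ.≤-trans (ℕ.+-monoˡ-≤ 1 k≤m) (ℕ.≤-reflexive (ℕ.+-comm m 1)))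

-- Bézout and gcd

coprime-∣ʳ : ∀ {x n d : ℤ} → Coprime x n → d ∣ n → Coprime x d
coprime-∣ʳ x⊥n d∣n (i∣x , i∣d) = x⊥n (i∣x , ℕ.∣-trans i∣d d∣n)

private
  abs-as-multiple : ∀ (a : ℤ) → ∃ λ σ → + ∣ a ∣ ≡ σ * a
  abs-as-multiple (+ n)    = 1ℤ , sym (*-identityˡ (+ n))
  abs-as-multiple -[1+ n ] = - 1ℤ , neg-as-multiple -[1+ n ]
    where
    neg-as-multiple : ∀ (x : ℤ) → - x ≡ (- 1ℤ) * x
    neg-as-multiple = solve-∀

  bézout-from-abs : ∀ (X Y A B σ τ a b : ℤ) → A ≡ σ * a → B ≡ τ * b → 1ℤ + Y * B ≡ X * A →
    (X * σ) * a + (- (Y * τ)) * b ≡ 1ℤ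
  bézout-from-abs X Y A B σ τ a b refl refl h =
    linear-combination₁ h (- 1ℤ) (solve (X ∷ Y ∷ σ ∷ τ ∷ a ∷ b ∷ []))

  lift-ℕ-identity : ∀ x y a b → 1 ℕ.+ y ℕ.* b ≡ x ℕ.* a → 1ℤ + + y * + b ≡ + x * + a
  lift-ℕ-identity x y a b eq =
    trans (cong (λ z → 1ℤ + z) (sym (pos-* y b))) (trans (sym (pos-+ 1 (y ℕ.* b))) (trans (cong +_ eq) (pos-* x a)))

bézout : ∀ {a b : ℤ} → Coprime a b → ∃₂ λ s t → s * a + t * b ≡ 1ℤ
bézout {a} {b} a⊥b with abs-as-multiple a | abs-as-multiple b | ℕ.coprime-Bézout a⊥b
... | σ , ∣a∣≡σa | τ , ∣b∣≡τb | ℕ.Bézout.+- x y eq =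
  + x * σ , - (+ y * τ) ,
  bézout-from-abs (+ x) (+ y) _ _ σ τ a b ∣a∣≡σa ∣b∣≡τb (lift-ℕ-identity x y ∣ a ∣ ∣ b ∣ eq)
... | σ , ∣a∣≡σa | τ , ∣b∣≡τb | ℕ.Bézout.-+ x y eq =
  - (+ x * σ) , + y * τ ,
  trans (+-comm (- (+ x * σ) * a) (+ y * τ * b))
        (bézout-from-abs (+ y) (+ x) _ _ τ σ b a ∣b∣≡τb ∣a∣≡σa (lift-ℕ-identity y x ∣ b ∣ ∣ a ∣ eq))

bézout⇒coprime : ∀ {a b : ℤ} s t → s * a + t * b ≡ 1ℤ → Coprime a b
bézout⇒coprime {a} {b} s t sa+tb≡1 {i} (i∣a , i∣b) =
  ℕ.∣1⇒≡1 (Signed.∣⇒∣ᵤ {+ i} {1ℤ} (subst (Signed._∣_ (+ i)) sa+tb≡1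
    (Signed.∣m∣n⇒∣m+n (Signed.∣n⇒∣m*n s (Signed.∣ᵤ⇒∣ {+ i} {a} i∣a))
                      (Signed.∣n⇒∣m*n t (Signed.∣ᵤ⇒∣ {+ i} {b} i∣b)))))

gcd[d*n,n*y]≡n : ∀ m {d y : ℤ} → Coprime y d → gcd (d * + suc m) (+ suc m * y) ≡ + suc m
gcd[d*n,n*y]≡n m {d} {y} y⊥d = cong +_ (begin
  ℕ.gcd (∣ d * + suc m ∣) (∣ + suc m * y ∣)  ≡⟨ cong₂ ℕ.gcd (abs-* d (+ suc m)) (abs-* (+ suc m) y) ⟩
  ℕ.gcd (∣ d ∣ ℕ.* suc m) (suc m ℕ.* ∣ y ∣)  ≡⟨ cong (λ x → ℕ.gcd x (suc m ℕ.* ∣ y ∣)) (ℕ.*-comm (∣ d ∣) (suc m)) ⟩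
  ℕ.gcd (suc m ℕ.* ∣ d ∣) (suc m ℕ.* ∣ y ∣)  ≡⟨ ℕ.c*gcd[m,n]≡gcd[cm,cn] (suc m) (∣ d ∣) (∣ y ∣) ⟨
  suc m ℕ.* ℕ.gcd (∣ d ∣) (∣ y ∣)            ≡⟨ cong (suc m ℕ.*_) (ℕ.coprime⇒gcd≡1 (ℕ.sym y⊥d)) ⟩
  suc m ℕ.* 1                               ≡⟨ ℕ.*-identityʳ (suc m) ⟩
  suc m                                     ∎)
  where open ≡-Reasoning

gcd[d*n,w*n]≡n⇒coprime : ∀ m {d w : ℤ} → gcd (d * + suc m) (w * + suc m) ≡ + suc m → Coprime w d
gcd[d*n,w*n]≡n⇒coprime m {d} {w} gcd≡n = ℕ.sym (ℕ.gcd≡1⇒coprime (ℕ.*-cancelˡ-≡ _ _ (suc m) (begin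
  suc m ℕ.* ℕ.gcd (∣ d ∣) (∣ w ∣)            ≡⟨ ℕ.c*gcd[m,n]≡gcd[cm,cn] (suc m) (∣ d ∣) (∣ w ∣) ⟩
  ℕ.gcd (suc m ℕ.* ∣ d ∣) (suc m ℕ.* ∣ w ∣)  ≡⟨ cong₂ ℕ.gcd (ℕ.*-comm (suc m) ∣ d ∣) (ℕ.*-comm (suc m) ∣ w ∣) ⟩
  ℕ.gcd (∣ d ∣ ℕ.* suc m) (∣ w ∣ ℕ.* suc m)  ≡⟨ cong₂ ℕ.gcd (abs-* d (+ suc m)) (abs-* w (+ suc m)) ⟨
  ℕ.gcd (∣ d * + suc m ∣) (∣ w * + suc m ∣)  ≡⟨ +-injective gcd≡n ⟩
  suc m                                     ≡⟨ ℕ.*-identityʳ (suc m) ⟨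
  suc m ℕ.* 1                               ∎)))
  where open ≡-Reasoning

∣-factors : ∀ a b c → (a ∣ a * b * c) × (a * c ∣ a * b * c) × (c ∣ a * b * c)
∣-factors a b c =
  quotient⇒∣ {a} {a * b * c} (b * c) (solve (a ∷ b ∷ c ∷ [])) ,
  quotient⇒∣ {a * c} {a * b * c} b (solve (a ∷ b ∷ c ∷ [])) ,
  quotient⇒∣ {c} {a * b * c} (a * b) (solve (a ∷ b ∷ c ∷ []))

-- Γ∞ × Γ∞ acting by row and column operations

addRows : ℤ → ℤ → ℤ → Mat3 → Mat3
addRows a b c A i0 j = A i0 j + a * A i1 j + b * A i2 j
addRows a b c A i1 j = A i1 j + c * A i2 j
addRows a b c A i2 j = A i2 j

addColumns : ℤ → ℤ → ℤ → Mat3 → Mat3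
addColumns a b c A i i0 = A i i0
addColumns a b c A i i1 = A i i1 + a * A i i0
addColumns a b c A i i2 = A i i2 + b * A i i0 + c * A i i1

unip-⊗ : ∀ a b c A → (unip a b c ⊗ A) ≋ addRows a b c A
unip-⊗ a b c A i0 j = row₀ (A i0 j) (A i1 j) (A i2 j) a b
  where
  row₀ : ∀ x y z a b → 1ℤ * x + a * y + b * z ≡ x + a * y + b * z
  row₀ = solve-∀
unip-⊗ a b c A i1 j = row₁ (A i0 j) (A i1 j) (A i2 j) c
  where
  row₁ : ∀ x y z c → 0ℤ * x + 1ℤ * y + c * z ≡ y + c * z
  row₁ = solve-∀
unip-⊗ a b c A i2 j = row₂ (A i0 j) (A i1 j) (A i2 j)
  where
  row₂ : ∀ x y z → 0ℤ * x + 0ℤ * y + 1ℤ * z ≡ z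
  row₂ = solve-∀

⊗-unip : ∀ A a b c → (A ⊗ unip a b c) ≋ addColumns a b c A
⊗-unip A a b c i i0 = column₀ (A i i0) (A i i1) (A i i2)
  where
  column₀ : ∀ x y z → x * 1ℤ + y * 0ℤ + z * 0ℤ ≡ x
  column₀ = solve-∀
⊗-unip A a b c i i1 = column₁ (A i i0) (A i i1) (A i i2) a
  where
  column₁ : ∀ x y z a → x * a + y * 1ℤ + z * 0ℤ ≡ y + a * x
  column₁ = solve-∀
⊗-unip A a b c i i2 = column₂ (A i i0) (A i i1) (A i i2) b c
  where
  column₂ : ∀ x y z b c → x * b + y * c + z * 1ℤ ≡ z + b * x + c * y
  column₂ = solve-∀

addColumns-cong : ∀ {A B} a b c → A ≋ B → addColumns a b c A ≋ addColumns a b c B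
addColumns-cong a b c A≋B i i0 = A≋B i i0
addColumns-cong a b c A≋B i i1 = cong₂ (λ x y → x + a * y) (A≋B i i1) (A≋B i i0)
addColumns-cong a b c A≋B i i2 =
  cong₂ (λ x y → x + c * y) (cong₂ (λ x y → x + b * y) (A≋B i i2) (A≋B i i0)) (A≋B i i1)

≋-trans : ∀ {A B C} → A ≋ B → B ≋ C → A ≋ C
≋-trans A≋B B≋C i j = trans (A≋B i j) (B≋C i j)

≋-sym : ∀ {A B} → A ≋ B → B ≋ A
≋-sym A≋B i j = sym (A≋B i j)

unip-⊗-⊗-unip : ∀ a b c A a' b' c' →
  ((unip a b c ⊗ A) ⊗ unip a' b' c') ≋ addColumns a' b' c' (addRows a b c A)
unip-⊗-⊗-unip a b c A a' b' c' =
  ≋-trans (⊗-unip (unip a b c ⊗ A) a' b' c') (addColumns-cong a' b' c' (unip-⊗ a b c A))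

≋⇒SameDoubleCoset : ∀ {A B} a b c a' b' c' → B ≋ addColumns a' b' c' (addRows a b c A) →
  SameDoubleCoset A B
≋⇒SameDoubleCoset {A} a b c a' b' c' B≋ =
  a , b , c , a' , b' , c' , ≋-trans B≋ (≋-sym (unip-⊗-⊗-unip a b c A a' b' c'))

det3-addRows : ∀ a b c A → det3 (addRows a b c A) ≡ det3 A
det3-addRows a b c A =
  invariance (A i0 i0) (A i0 i1) (A i0 i2) (A i1 i0) (A i1 i1) (A i1 i2) (A i2 i0) (A i2 i1) (A i2 i2) a b c
  where
  invariance : ∀ e₀₀ e₀₁ e₀₂ e₁₀ e₁₁ e₁₂ e₂₀ e₂₁ e₂₂ a b c →
      (e₀₀ + a * e₁₀ + b * e₂₀) * ((e₁₁ + c * e₂₁) * e₂₂ - (e₁₂ + c * e₂₂) * e₂₁)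
    - (e₀₁ + a * e₁₁ + b * e₂₁) * ((e₁₀ + c * e₂₀) * e₂₂ - (e₁₂ + c * e₂₂) * e₂₀)
    + (e₀₂ + a * e₁₂ + b * e₂₂) * ((e₁₀ + c * e₂₀) * e₂₁ - (e₁₁ + c * e₂₁) * e₂₀)
    ≡ e₀₀ * (e₁₁ * e₂₂ - e₁₂ * e₂₁) - e₀₁ * (e₁₀ * e₂₂ - e₁₂ * e₂₀) + e₀₂ * (e₁₀ * e₂₁ - e₁₁ * e₂₀)
  invariance = solve-∀

det3-addColumns : ∀ a b c A → det3 (addColumns a b c A) ≡ det3 A
det3-addColumns a b c A =
  invariance (A i0 i0) (A i0 i1) (A i0 i2) (A i1 i0) (A i1 i1) (A i1 i2) (A i2 i0) (A i2 i1) (A i2 i2) a b c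
  where
  invariance : ∀ e₀₀ e₀₁ e₀₂ e₁₀ e₁₁ e₁₂ e₂₀ e₂₁ e₂₂ a b c →
      e₀₀ * ((e₁₁ + a * e₁₀) * (e₂₂ + b * e₂₀ + c * e₂₁) - (e₁₂ + b * e₁₀ + c * e₁₁) * (e₂₁ + a * e₂₀))
    - (e₀₁ + a * e₀₀) * (e₁₀ * (e₂₂ + b * e₂₀ + c * e₂₁) - (e₁₂ + b * e₁₀ + c * e₁₁) * e₂₀)
    + (e₀₂ + b * e₀₀ + c * e₀₁) * (e₁₀ * (e₂₁ + a * e₂₀) - (e₁₁ + a * e₁₀) * e₂₀)
    ≡ e₀₀ * (e₁₁ * e₂₂ - e₁₂ * e₂₁) - e₀₁ * (e₁₀ * e₂₂ - e₁₂ * e₂₀) + e₀₂ * (e₁₀ * e₂₁ - e₁₁ * e₂₀)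
  invariance = solve-∀

det3-cong : ∀ {A B} → A ≋ B → det3 A ≡ det3 B
det3-cong A≋B rewrite A≋B i0 i0 | A≋B i0 i1 | A≋B i0 i2 | A≋B i1 i0 | A≋B i1 i1 | A≋B i1 i2
                    | A≋B i2 i0 | A≋B i2 i1 | A≋B i2 i2 = refl

withColumn₀ : (Fin 3 → ℤ) → Mat3 → Mat3
withColumn₀ v B i i0      = v i
withColumn₀ v B i (suc k) = B i (suc k)

withColumn₁ : (Fin 3 → ℤ) → Mat3 → Mat3
withColumn₁ v B i i1 = v i
withColumn₁ v B i i0 = B i i0
withColumn₁ v B i i2 = B i i2

private
  cramer : ∀ b₀₀ b₀₁ b₀₂ b₁₀ b₁₁ b₁₂ b₂₀ b₂₁ b₂₂ g₀ g₁ g₂ →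
    let D = λ (a b c d e f g h i : ℤ) → a * (e * i - f * h) - b * (d * i - f * g) + c * (d * h - e * g)
        X = D (g₀ - b₀₂) b₀₁ b₀₂ (g₁ - b₁₂) b₁₁ b₁₂ (g₂ - b₂₂) b₂₁ b₂₂
        Y = D b₀₀ (g₀ - b₀₂) b₀₂ b₁₀ (g₁ - b₁₂) b₁₂ b₂₀ (g₂ - b₂₂) b₂₂
    in D b₀₀ b₀₁ g₀ b₁₀ b₁₁ g₁ b₂₀ b₂₁ g₂ ≡ 1ℤ → D b₀₀ b₀₁ b₀₂ b₁₀ b₁₁ b₁₂ b₂₀ b₂₁ b₂₂ ≡ 1ℤ →
    (g₀ ≡ b₀₂ + X * b₀₀ + Y * b₀₁) × (g₁ ≡ b₁₂ + X * b₁₀ + Y * b₁₁) × (g₂ ≡ b₂₂ + X * b₂₀ + Y * b₂₁)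
  cramer b₀₀ b₀₁ b₀₂ b₁₀ b₁₁ b₁₂ b₂₀ b₂₁ b₂₂ g₀ g₁ g₂ detA detB =
    linear-combination₂ detA detB b₀₂ (- g₀) (solve (b₀₀ ∷ b₀₁ ∷ b₀₂ ∷ b₁₀ ∷ b₁₁ ∷ b₁₂ ∷ b₂₀ ∷ b₂₁ ∷ b₂₂ ∷ g₀ ∷ g₁ ∷ g₂ ∷ [])) ,
    linear-combination₂ detA detB b₁₂ (- g₁) (solve (b₀₀ ∷ b₀₁ ∷ b₀₂ ∷ b₁₀ ∷ b₁₁ ∷ b₁₂ ∷ b₂₀ ∷ b₂₁ ∷ b₂₂ ∷ g₀ ∷ g₁ ∷ g₂ ∷ [])) ,
    linear-combination₂ detA detB b₂₂ (- g₂) (solve (b₀₀ ∷ b₀₁ ∷ b₀₂ ∷ b₁₀ ∷ b₁₁ ∷ b₁₂ ∷ b₂₀ ∷ b₂₁ ∷ b₂₂ ∷ g₀ ∷ g₁ ∷ g₂ ∷ []))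

-- Cramer's rule for the difference δ of the third columns: its coordinate along B's
-- third column is det (B₀ , B₁ , δ) = det A - det B = 0.
columns₀₁-determine-column₂ : ∀ {A B} → det3 A ≡ 1ℤ → det3 B ≡ 1ℤ →
  (∀ i → A i i0 ≡ B i i0) → (∀ i → A i i1 ≡ B i i1) →
  ∃₂ λ x y → ∀ i → A i i2 ≡ B i i2 + x * B i i0 + y * B i i1
columns₀₁-determine-column₂ {A} {B} detA detB A₀≡B₀ A₁≡B₁ =
  X , Y , λ { i0 → proj₁ column₂ ; i1 → proj₁ (proj₂ column₂) ; i2 → proj₂ (proj₂ column₂) }
  where
  δ : Fin 3 → ℤ
  δ i = A i i2 - B i i2
  X Y : ℤ
  X = det3 (withColumn₀ δ B)
  Y = det3 (withColumn₁ δ B)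
  detA′ : det3 (withColumn₀ (λ i → B i i0) (withColumn₁ (λ i → B i i1) A)) ≡ 1ℤ
  detA′ = trans (sym (det3-cong agree)) detA
    where
    agree : A ≋ withColumn₀ (λ i → B i i0) (withColumn₁ (λ i → B i i1) A)
    agree i i0 = A₀≡B₀ i
    agree i i1 = A₁≡B₁ i
    agree i i2 = refl
  column₂ : (A i0 i2 ≡ B i0 i2 + X * B i0 i0 + Y * B i0 i1) × (A i1 i2 ≡ B i1 i2 + X * B i1 i0 + Y * B i1 i1)
          × (A i2 i2 ≡ B i2 i2 + X * B i2 i0 + Y * B i2 i1)
  column₂ = cramer (B i0 i0) (B i0 i1) (B i0 i2) (B i1 i0) (B i1 i1) (B i1 i2) (B i2 i0) (B i2 i1) (B i2 i2)
                   (A i0 i2) (A i1 i2) (A i2 i2) detA′ detB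

sameDoubleCoset-from-columns₀₁ : ∀ {M A} γ b c α → det3 M ≡ 1ℤ → det3 A ≡ 1ℤ →
  (∀ i → A i i0 ≡ addColumns α 0ℤ 0ℤ (addRows γ b c M) i i0) →
  (∀ i → A i i1 ≡ addColumns α 0ℤ 0ℤ (addRows γ b c M) i i1) →
  SameDoubleCoset M A
sameDoubleCoset-from-columns₀₁ {M} {A} γ b c α detM detA A₀≡ A₁≡ =
  ≋⇒SameDoubleCoset γ b c α (x + α * y) y A≋
  where
  R B : Mat3
  R = addRows γ b c M
  B = addColumns α 0ℤ 0ℤ R
  detB : det3 B ≡ 1ℤ
  detB = trans (det3-addColumns α 0ℤ 0ℤ R) (trans (det3-addRows γ b c M) detM)
  column₂ : ∃₂ λ x y → ∀ i → A i i2 ≡ B i i2 + x * B i i0 + y * B i i1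
  column₂ = columns₀₁-determine-column₂ {A} {B} detA detB A₀≡ A₁≡
  x y : ℤ
  x = proj₁ column₂
  y = proj₁ (proj₂ column₂)
  regroup : ∀ r₀ r₁ r₂ α x y → (r₂ + 0ℤ * r₀ + 0ℤ * r₁) + x * r₀ + y * (r₁ + α * r₀) ≡ r₂ + (x + α * y) * r₀ + y * r₁
  regroup = solve-∀
  A≋ : A ≋ addColumns α (x + α * y) y R
  A≋ i i0 = A₀≡ i
  A≋ i i1 = A₁≡ i
  A≋ i i2 = trans (proj₂ (proj₂ column₂) i) (regroup (R i i0) (R i i1) (R i i2) α x y)

matrix : ℤ → ℤ → ℤ → ℤ → ℤ → ℤ → ℤ → ℤ → ℤ → Mat3
matrix e₀₀ e₀₁ e₀₂ e₁₀ e₁₁ e₁₂ e₂₀ e₂₁ e₂₂ i0 i0 = e₀₀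
matrix e₀₀ e₀₁ e₀₂ e₁₀ e₁₁ e₁₂ e₂₀ e₂₁ e₂₂ i0 i1 = e₀₁
matrix e₀₀ e₀₁ e₀₂ e₁₀ e₁₁ e₁₂ e₂₀ e₂₁ e₂₂ i0 i2 = e₀₂
matrix e₀₀ e₀₁ e₀₂ e₁₀ e₁₁ e₁₂ e₂₀ e₂₁ e₂₂ i1 i0 = e₁₀
matrix e₀₀ e₀₁ e₀₂ e₁₀ e₁₁ e₁₂ e₂₀ e₂₁ e₂₂ i1 i1 = e₁₁
matrix e₀₀ e₀₁ e₀₂ e₁₀ e₁₁ e₁₂ e₂₀ e₂₁ e₂₂ i1 i2 = e₁₂
matrix e₀₀ e₀₁ e₀₂ e₁₀ e₁₁ e₁₂ e₂₀ e₂₁ e₂₂ i2 i0 = e₂₀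
matrix e₀₀ e₀₁ e₀₂ e₁₀ e₁₁ e₁₂ e₂₀ e₂₁ e₂₂ i2 i1 = e₂₁
matrix e₀₀ e₀₁ e₀₂ e₁₀ e₁₁ e₁₂ e₂₀ e₂₁ e₂₂ i2 i2 = e₂₂

-- The matrix attached to the parameters

module ImageMatrix (d₁ d₂ f x₂ y₁ x₃ y₃ k x̄ ȳ : ℤ) where

  -- with x̄ = xbar x₂ and ȳ = ybar y₁ this is definitionally IsImage d₁ d₂ f xbar ybar;
  -- abstracting them to variables lets the ring solver treat them as atoms
  IsImageMatrix : Mat3 → Set
  IsImageMatrix = IsImage d₁ d₂ f (λ _ → x̄) (λ _ → ȳ) (x₂ , y₁ , x₃ , y₃ , k)

  module Construction (p q r : ℤ) (hp : x₂ * x̄ - 1ℤ ≡ p * d₂) (hq : y₁ * ȳ - 1ℤ ≡ q * d₁)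
                      (hr : x₃ * y₃ - 1ℤ ≡ r * f) where

    -- the entries of the statement, evaluated using x₂ x̄ = 1 + p d₂, y₁ ȳ = 1 + q d₁ and x₃ y₃ = 1 + r f
    imageMatrix : Mat3
    imageMatrix i0 i0 = d₁ * x₃ * p + ȳ * x₂ + d₁ * k * x₂
    imageMatrix i0 i1 = x₃ * y₁ * p + x₂ * q + k * x₂ * y₁
    imageMatrix i0 i2 = r * p
    imageMatrix i1 i0 = d₁ * x₃ * x̄ + d₂ * ȳ + d₁ * d₂ * k
    imageMatrix i1 i1 = x₃ * x̄ * y₁ + d₂ * q + d₂ * k * y₁
    imageMatrix i1 i2 = x̄ * r
    imageMatrix i2 i0 = d₁ * f
    imageMatrix i2 i1 = f * y₁
    imageMatrix i2 i2 = y₃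

    imageMatrix-isImage : IsImageMatrix imageMatrix
    imageMatrix-isImage = entry₀₀ , entry₀₁ , entry₀₂ , refl , entry₁₁ , entry₁₂ , refl , refl , refl
      where
      entry₀₀ : d₂ * (d₁ * x₃ * p + ȳ * x₂ + d₁ * k * x₂) ≡ (d₁ * x₃ * x̄ + d₂ * ȳ + d₁ * d₂ * k) * x₂ - d₁ * x₃
      entry₀₀ = linear-combination₁ hp (- (d₁ * x₃)) (solve (d₁ ∷ d₂ ∷ x₂ ∷ y₁ ∷ x₃ ∷ k ∷ x̄ ∷ ȳ ∷ p ∷ []))
      entry₀₁ : d₁ * d₂ * (x₃ * y₁ * p + x₂ * q + k * x₂ * y₁)
              ≡ (d₁ * x₃ * x̄ + d₂ * ȳ + d₁ * d₂ * k) * x₂ * y₁ - d₁ * x₃ * y₁ - x₂ * d₂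
      entry₀₁ = linear-combination₂ hp hq (- (d₁ * x₃ * y₁)) (- (d₂ * x₂))
        (solve (d₁ ∷ d₂ ∷ x₂ ∷ y₁ ∷ x₃ ∷ k ∷ x̄ ∷ ȳ ∷ p ∷ q ∷ []))
      entry₀₂ : d₁ * d₂ * f * (r * p)
              ≡ - (d₂ * ȳ * y₃ + d₁ * x̄ + d₁ * d₂ * y₃ * k) * x₂
                + (d₁ * x₃ * x̄ + d₂ * ȳ + d₁ * d₂ * k) * x₂ * y₃ + d₁ * (1ℤ - x₃ * y₃)
      entry₀₂ = linear-combination₂ hp hr (- (d₁ * (x₃ * y₃ - 1ℤ))) (- (d₁ * (p * d₂)))
        (solve (d₁ ∷ d₂ ∷ f ∷ x₂ ∷ x₃ ∷ y₃ ∷ k ∷ x̄ ∷ ȳ ∷ p ∷ r ∷ []))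
      entry₁₁ : d₁ * (x₃ * x̄ * y₁ + d₂ * q + d₂ * k * y₁) ≡ (d₁ * x₃ * x̄ + d₂ * ȳ + d₁ * d₂ * k) * y₁ - d₂
      entry₁₁ = linear-combination₁ hq (- d₂) (solve (d₁ ∷ d₂ ∷ y₁ ∷ x₃ ∷ k ∷ x̄ ∷ ȳ ∷ q ∷ []))
      entry₁₂ : d₁ * f * (x̄ * r)
              ≡ (d₁ * x₃ * x̄ + d₂ * ȳ + d₁ * d₂ * k) * y₃ - (d₂ * ȳ * y₃ + d₁ * x̄ + d₁ * d₂ * y₃ * k)
      entry₁₂ = linear-combination₁ hr (- (d₁ * x̄)) (solve (d₁ ∷ d₂ ∷ f ∷ x₃ ∷ y₃ ∷ k ∷ x̄ ∷ ȳ ∷ r ∷ []))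

  module _ (d₁≢0 : d₁ ≢ 0ℤ) (d₂≢0 : d₂ ≢ 0ℤ) where

    top-row-relation : ∀ e₀₀ e₀₁ →
      d₂ * e₀₀ ≡ (d₁ * x₃ * x̄ + d₂ * ȳ + d₁ * d₂ * k) * x₂ - d₁ * x₃ →
      d₁ * d₂ * e₀₁ ≡ (d₁ * x₃ * x̄ + d₂ * ȳ + d₁ * d₂ * k) * x₂ * y₁ - d₁ * x₃ * y₁ - x₂ * d₂ →
      d₁ * e₀₁ ≡ e₀₀ * y₁ - x₂
    top-row-relation e₀₀ e₀₁ h₀₀ h₀₁ = *-cancelˡ-≢0 d₂ d₂≢0
      (linear-combination₂ h₀₁ h₀₀ 1ℤ (- y₁) (solve (d₁ ∷ d₂ ∷ x₂ ∷ y₁ ∷ x₃ ∷ k ∷ x̄ ∷ ȳ ∷ e₀₀ ∷ e₀₁ ∷ [])))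

    private
      det-of-image : ∀ e₀₀ e₀₁ e₀₂ e₁₀ e₁₁ e₁₂ e₂₀ e₂₁ e₂₂ →
        let u = d₁ * x₃ * x̄ + d₂ * ȳ + d₁ * d₂ * k
            v = d₂ * ȳ * y₃ + d₁ * x̄ + d₁ * d₂ * y₃ * k in
        d₂ * e₀₀ ≡ u * x₂ - d₁ * x₃ → d₁ * d₂ * e₀₁ ≡ u * x₂ * y₁ - d₁ * x₃ * y₁ - x₂ * d₂ →
        d₁ * d₂ * f * e₀₂ ≡ - v * x₂ + u * x₂ * y₃ + d₁ * (1ℤ - x₃ * y₃) →
        e₁₀ ≡ u → d₁ * e₁₁ ≡ u * y₁ - d₂ → d₁ * f * e₁₂ ≡ u * y₃ - v →
        e₂₀ ≡ d₁ * f → e₂₁ ≡ f * y₁ → e₂₂ ≡ y₃ →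
        e₀₀ * (e₁₁ * e₂₂ - e₁₂ * e₂₁) - e₀₁ * (e₁₀ * e₂₂ - e₁₂ * e₂₀) + e₀₂ * (e₁₀ * e₂₁ - e₁₁ * e₂₀) ≡ 1ℤ
      det-of-image e₀₀ e₀₁ e₀₂ _ e₁₁ e₁₂ _ _ _ h₀₀ h₀₁ h₀₂ refl h₁₁ h₁₂ refl refl refl =
        linear-combination₄ minor₀₁ top-row h₁₁ corner y₃ (f * e₁₂) (- (f * e₀₂)) 1ℤ
          (solve (d₁ ∷ d₂ ∷ f ∷ x₂ ∷ y₁ ∷ x₃ ∷ y₃ ∷ k ∷ x̄ ∷ ȳ ∷ e₀₀ ∷ e₀₁ ∷ e₀₂ ∷ e₁₁ ∷ e₁₂ ∷ []))
        where
        top-row : d₁ * e₀₁ ≡ e₀₀ * y₁ - x₂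
        top-row = top-row-relation e₀₀ e₀₁ h₀₀ h₀₁
        minor₀₁ : e₀₀ * e₁₁ - e₀₁ * (d₁ * x₃ * x̄ + d₂ * ȳ + d₁ * d₂ * k) ≡ x₃
        minor₀₁ = *-cancelˡ-≢0 d₁ d₁≢0 (linear-combination₃ h₁₁ top-row h₀₀ e₀₀ (- (d₁ * x₃ * x̄ + d₂ * ȳ + d₁ * d₂ * k)) (- 1ℤ)
          (solve (d₁ ∷ d₂ ∷ x₂ ∷ y₁ ∷ x₃ ∷ k ∷ x̄ ∷ ȳ ∷ e₀₀ ∷ e₀₁ ∷ e₁₁ ∷ [])))
        corner : d₂ * f * e₀₂ ≡ x₂ * f * e₁₂ + 1ℤ - x₃ * y₃
        corner = *-cancelˡ-≢0 d₁ d₁≢0 (linear-combination₂ h₀₂ h₁₂ 1ℤ (- x₂)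
          (solve (d₁ ∷ d₂ ∷ f ∷ x₂ ∷ x₃ ∷ y₃ ∷ k ∷ x̄ ∷ ȳ ∷ e₀₂ ∷ e₁₂ ∷ [])))

    image-det : ∀ {M} → IsImageMatrix M → det3 M ≡ 1ℤ
    image-det {M} (h₀₀ , h₀₁ , h₀₂ , h₁₀ , h₁₁ , h₁₂ , h₂₀ , h₂₁ , h₂₂) =
      det-of-image (M i0 i0) (M i0 i1) (M i0 i2) (M i1 i0) (M i1 i1) (M i1 i2) (M i2 i0) (M i2 i1) (M i2 i2)
                   h₀₀ h₀₁ h₀₂ h₁₀ h₁₁ h₁₂ h₂₀ h₂₁ h₂₂

  image-minor : ∀ {M} → IsImageMatrix M → M i1 i0 * M i2 i1 - M i1 i1 * M i2 i0 ≡ d₂ * f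
  image-minor {M} (_ , _ , _ , h₁₀ , h₁₁ , _ , h₂₀ , h₂₁ , _) =
    minor-of-image (M i1 i0) (M i1 i1) (M i2 i0) (M i2 i1) h₁₀ h₁₁ h₂₀ h₂₁
    where
    minor-of-image : ∀ e₁₀ e₁₁ e₂₀ e₂₁ → e₁₀ ≡ d₁ * x₃ * x̄ + d₂ * ȳ + d₁ * d₂ * k →
      d₁ * e₁₁ ≡ (d₁ * x₃ * x̄ + d₂ * ȳ + d₁ * d₂ * k) * y₁ - d₂ → e₂₀ ≡ d₁ * f → e₂₁ ≡ f * y₁ →
      e₁₀ * e₂₁ - e₁₁ * e₂₀ ≡ d₂ * f
    minor-of-image _ e₁₁ _ _ refl h₁₁ refl refl =
      linear-combination₁ h₁₁ (- f) (solve (d₁ ∷ d₂ ∷ f ∷ y₁ ∷ x₃ ∷ k ∷ x̄ ∷ ȳ ∷ e₁₁ ∷ []))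

module InjectivityAlgebra (d₁ d₂ f : ℤ) (d₁≢0 : d₁ ≢ 0ℤ) (d₂≢0 : d₂ ≢ 0ℤ) (f≢0 : f ≢ 0ℤ) where

  y₁-congruence : ∀ y₁ y₁' a' → f * y₁' ≡ f * y₁ + a' * (d₁ * f) → y₁' - y₁ ≡ a' * d₁
  y₁-congruence y₁ y₁' a' h = *-cancelˡ-≢0 f f≢0 (linear-combination₁ h 1ℤ (solve (d₁ ∷ f ∷ y₁ ∷ y₁' ∷ a' ∷ [])))

  y₃-congruence : ∀ y₁ y₃ y₃' b' c' → y₃' ≡ y₃ + b' * (d₁ * f) + c' * (f * y₁) →
    y₃' - y₃ ≡ (b' * d₁ + c' * y₁) * f
  y₃-congruence y₁ y₃ y₃' b' c' h = linear-combination₁ h 1ℤ (solve (d₁ ∷ f ∷ y₁ ∷ y₃ ∷ y₃' ∷ b' ∷ c' ∷ []))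

  x₂-congruence : ∀ y₁ x₂ x₂' a b a' u e₀₀ e₀₁ e₁₁ g₀₀ g₀₁ →
    d₁ * g₀₁ ≡ g₀₀ * y₁ - x₂' → d₁ * e₀₁ ≡ e₀₀ * y₁ - x₂ → d₁ * e₁₁ ≡ u * y₁ - d₂ →
    g₀₀ ≡ e₀₀ + a * u + b * (d₁ * f) →
    g₀₁ ≡ (e₀₁ + a * e₁₁ + b * (f * y₁)) + a' * (e₀₀ + a * u + b * (d₁ * f)) → a' ≡ 0ℤ →
    x₂' - x₂ ≡ a * d₂
  x₂-congruence y₁ x₂ x₂' a b a' u e₀₀ e₀₁ e₁₁ _ _ top-row′ top-row h₁₁ refl refl refl =
    linear-combination₃ top-row′ top-row h₁₁ 1ℤ (- 1ℤ) (- a)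
      (solve (d₁ ∷ d₂ ∷ f ∷ y₁ ∷ x₂ ∷ x₂' ∷ a ∷ b ∷ u ∷ e₀₀ ∷ e₀₁ ∷ e₁₁ ∷ []))

  x₃-congruence : ∀ x₃ x₃' y₃ r r' → x₃ * y₃ - 1ℤ ≡ r * f → x₃' * y₃ - 1ℤ ≡ r' * f →
    x₃' - x₃ ≡ (x₃ * r' - x₃' * r) * f
  x₃-congruence x₃ x₃' y₃ r r' hr hr' =
    linear-combination₂ hr' hr x₃ (- x₃') (solve (f ∷ x₃ ∷ x₃' ∷ y₃ ∷ r ∷ r' ∷ []))

  module _ (x₃ y₃ x̄ ȳ k k' : ℤ) where

    k-difference : ∀ c → d₁ * x₃ * x̄ + d₂ * ȳ + d₁ * d₂ * k' ≡ (d₁ * x₃ * x̄ + d₂ * ȳ + d₁ * d₂ * k) + c * (d₁ * f) →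
      d₂ * (k' - k) ≡ c * f
    k-difference c h = *-cancelˡ-≢0 d₁ d₁≢0
      (linear-combination₁ h 1ℤ (solve (d₁ ∷ d₂ ∷ f ∷ x₃ ∷ x̄ ∷ ȳ ∷ k ∷ k' ∷ c ∷ [])))

    -- both entries equal x̄ (x₃ y₃ - 1) / f
    entry₁₂-independent-of-k : ∀ e₁₂ g₁₂ →
      d₁ * f * g₁₂ ≡ (d₁ * x₃ * x̄ + d₂ * ȳ + d₁ * d₂ * k') * y₃ - (d₂ * ȳ * y₃ + d₁ * x̄ + d₁ * d₂ * y₃ * k') →
      d₁ * f * e₁₂ ≡ (d₁ * x₃ * x̄ + d₂ * ȳ + d₁ * d₂ * k) * y₃ - (d₂ * ȳ * y₃ + d₁ * x̄ + d₁ * d₂ * y₃ * k) →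
      g₁₂ ≡ e₁₂
    entry₁₂-independent-of-k e₁₂ g₁₂ h′ h = *-cancelˡ-≢0 f f≢0 (*-cancelˡ-≢0 d₁ d₁≢0
      (linear-combination₂ h′ h 1ℤ (- 1ℤ) (solve (d₁ ∷ d₂ ∷ f ∷ x₃ ∷ y₃ ∷ x̄ ∷ ȳ ∷ k ∷ k' ∷ e₁₂ ∷ g₁₂ ∷ []))))

  c-relation : ∀ y₁ y₃ u c b' c' e₁₁ e₁₂ g₁₂ →
    g₁₂ ≡ (e₁₂ + c * y₃) + b' * (u + c * (d₁ * f)) + c' * (e₁₁ + c * (f * y₁)) → g₁₂ ≡ e₁₂ →
    b' * d₁ + c' * y₁ ≡ 0ℤ → d₁ * e₁₁ ≡ u * y₁ - d₂ → c * y₃ * d₁ ≡ c' * d₂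
  c-relation y₁ y₃ u c b' c' e₁₁ e₁₂ g₁₂ h₁₂ g₁₂≡e₁₂ h₂₂ h₁₁ =
    linear-combination₄ h₁₂ g₁₂≡e₁₂ h₂₂ h₁₁ (- d₁) d₁ (- (u + c * (d₁ * f))) (- c')
      (solve (d₁ ∷ d₂ ∷ f ∷ y₁ ∷ y₃ ∷ u ∷ c ∷ b' ∷ c' ∷ e₁₁ ∷ e₁₂ ∷ g₁₂ ∷ []))

  c'-multiple-of-d₁ : ∀ y₁ b' c' → Coprime y₁ d₁ → b' * d₁ + c' * y₁ ≡ 0ℤ → ∃ λ τ → c' ≡ τ * d₁
  c'-multiple-of-d₁ y₁ b' c' y₁⊥d₁ h = ∣⇒∃-quotient {d₁} {c'}
    (coprime-divisor d₁ y₁ c' (Coprime.sym {y₁} {d₁} y₁⊥d₁)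
      (quotient⇒∣ {d₁} {y₁ * c'} (- b') (linear-combination₁ h 1ℤ (solve (d₁ ∷ y₁ ∷ b' ∷ c' ∷ [])))))

  k-congruence : ∀ K x₃ y₃ r c c' τ → d₂ * K ≡ c * f → c * y₃ * d₁ ≡ c' * d₂ → c' ≡ τ * d₁ →
    x₃ * y₃ - 1ℤ ≡ r * f → K ≡ (x₃ * τ - r * K) * f
  k-congruence K x₃ y₃ r c c' τ h₁₀ hc hτ hr =
    linear-combination₂ Ky₃≡τf hr x₃ (- K) (solve (f ∷ K ∷ x₃ ∷ y₃ ∷ r ∷ τ ∷ []))
    where
    Ky₃≡τf : K * y₃ ≡ τ * f
    Ky₃≡τf = *-cancelˡ-≢0 d₂ d₂≢0 (*-cancelˡ-≢0 d₁ d₁≢0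
      (linear-combination₃ h₁₀ hc hτ (d₁ * y₃) f (f * d₂) (solve (d₁ ∷ d₂ ∷ f ∷ K ∷ y₃ ∷ c ∷ c' ∷ τ ∷ []))))

-- minorᵢⱼ is the 2 × 2 minor of rows i, j in the first two columns of A, divided by f
-- when the bottom row is involved
module SurjectivityAlgebra (d₁ d₂ f : ℤ) where

  reduced-minor₁₂ : ∀ w a₁₀ a₁₁ → f ≢ 0ℤ → a₁₀ * (w * f) - a₁₁ * (d₁ * f) ≡ d₂ * f → a₁₀ * w - a₁₁ * d₁ ≡ d₂
  reduced-minor₁₂ w a₁₀ a₁₁ f≢0 h =
    *-cancelˡ-≢0 f f≢0 (linear-combination₁ h 1ℤ (solve (d₁ ∷ d₂ ∷ f ∷ w ∷ a₁₀ ∷ a₁₁ ∷ [])))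

  module _ (w a₀₀ a₀₁ a₀₂ a₁₀ a₁₁ a₁₂ a₂₂ : ℤ)
    (det≡1 : a₀₀ * (a₁₁ * a₂₂ - a₁₂ * (w * f)) - a₀₁ * (a₁₀ * a₂₂ - a₁₂ * (d₁ * f))
             + a₀₂ * (a₁₀ * (w * f) - a₁₁ * (d₁ * f)) ≡ 1ℤ) where

    -- a₀₀ a₁₁ - a₀₁ a₁₀ = s (a₁₁ m - a₀₁ d₂) + t (a₁₀ m - a₀₀ d₂) for m = a₀₀ w - a₀₁ d₁ and
    -- s w + t d₁ = 1, so the cofactor expansion of det A along its last column is a
    -- combination of m and d₂
    private
      cofactor-combination : ∀ s t → s * w + t * d₁ ≡ 1ℤ → a₁₀ * w - a₁₁ * d₁ ≡ d₂ →
        (- (a₁₂ * f) + a₂₂ * (s * a₁₁ + t * a₁₀)) * (a₀₀ * w - a₀₁ * d₁)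
          + (a₀₂ * f - a₂₂ * (s * a₀₁ + t * a₀₀)) * d₂ ≡ 1ℤ
      cofactor-combination s t sw+td₁≡1 minor₁₂ =
        linear-combination₃ det≡1 sw+td₁≡1 minor₁₂ 1ℤ (a₂₂ * (a₀₀ * a₁₁ - a₀₁ * a₁₀)) (- (a₀₂ * f - a₂₂ * (s * a₀₁ + t * a₀₀)))
          (solve (d₁ ∷ d₂ ∷ f ∷ w ∷ s ∷ t ∷ a₀₀ ∷ a₀₁ ∷ a₀₂ ∷ a₁₀ ∷ a₁₁ ∷ a₁₂ ∷ a₂₂ ∷ []))

    reduced-minor₀₂⊥d₂ : Coprime w d₁ → a₁₀ * w - a₁₁ * d₁ ≡ d₂ → Coprime (a₀₀ * w - a₀₁ * d₁) d₂
    reduced-minor₀₂⊥d₂ w⊥d₁ minor₁₂ with bézout {w} {d₁} w⊥d₁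
    ... | s , t , sw+td₁≡1 = bézout⇒coprime {a₀₀ * w - a₀₁ * d₁} {d₂}
      (- (a₁₂ * f) + a₂₂ * (s * a₁₁ + t * a₁₀)) (a₀₂ * f - a₂₂ * (s * a₀₁ + t * a₀₀))
      (cofactor-combination s t sw+td₁≡1 minor₁₂)

    minor₀₁-inverts-a₂₂ : ∀ x₃ y₃ γ₃ β → (a₀₀ * a₁₁ - a₀₁ * a₁₀) - x₃ ≡ γ₃ * f → a₂₂ - y₃ ≡ β * f →
      f ∣ x₃ * y₃ - 1ℤ
    minor₀₁-inverts-a₂₂ x₃ y₃ γ₃ β hx hy = quotient⇒∣ {f} {x₃ * y₃ - 1ℤ}
      (w * (a₀₀ * a₁₂ - a₀₂ * a₁₀) - d₁ * (a₀₁ * a₁₂ - a₀₂ * a₁₁) - γ₃ * a₂₂ - β * (a₀₀ * a₁₁ - a₀₁ * a₁₀) + γ₃ * β * f)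
      (linear-combination₃ det≡1 hx hy 1ℤ (- (a₂₂ - β * f)) (- x₃)
        (solve (d₁ ∷ f ∷ w ∷ a₀₀ ∷ a₀₁ ∷ a₀₂ ∷ a₁₀ ∷ a₁₁ ∷ a₁₂ ∷ a₂₂ ∷ x₃ ∷ y₃ ∷ γ₃ ∷ β ∷ [])))

  residue-of-quotient : ∀ ρ k x s t κ → ρ * s - k ≡ κ * f → s * x + t * f ≡ 1ℤ → ρ - k * x ≡ f * (ρ * t + κ * x)
  residue-of-quotient ρ k x s t κ hk bézout =
    linear-combination₂ hk bézout x (- ρ) (solve (f ∷ ρ ∷ k ∷ x ∷ s ∷ t ∷ κ ∷ []))

  module TopLeftCongruences (a₀₀ a₀₁ a₁₀ a₁₁ w y₁ α x₂ γ x₃ x̄ ȳ p : ℤ)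
    (w≡y₁ : w - y₁ ≡ α * d₁) (minor₁₂ : a₁₀ * w - a₁₁ * d₁ ≡ d₂)
    (x₂≡minor₀₂ : (a₀₀ * w - a₀₁ * d₁) - x₂ ≡ γ * d₂) (x̄-inverse : x₂ * x̄ - 1ℤ ≡ p * d₂) where

    d₁∣y₁θ : ∀ q → y₁ * ȳ - 1ℤ ≡ q * d₁ → d₁ ∣ y₁ * (a₀₀ - γ * a₁₀ - ȳ * x₂ - d₁ * x₃ * p)
    d₁∣y₁θ q ȳ-inverse = quotient⇒∣ {d₁} {y₁ * (a₀₀ - γ * a₁₀ - ȳ * x₂ - d₁ * x₃ * p)}
      (- (x₂ * q) + a₀₁ - a₀₀ * α + γ * (a₁₀ * α - a₁₁) - x₃ * p * y₁)
      (linear-combination₄ x₂≡minor₀₂ w≡y₁ minor₁₂ ȳ-inverse 1ℤ (γ * a₁₀ - a₀₀) (- γ) (- x₂)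
        (solve (d₁ ∷ d₂ ∷ a₀₀ ∷ a₀₁ ∷ a₁₀ ∷ a₁₁ ∷ w ∷ y₁ ∷ α ∷ x₂ ∷ γ ∷ ȳ ∷ q ∷ x₃ ∷ p ∷ [])))

    image-entry₀₀ : ∀ k e₀₀ → d₂ ≢ 0ℤ → d₂ * e₀₀ ≡ (d₁ * x₃ * x̄ + d₂ * ȳ + d₁ * d₂ * k) * x₂ - d₁ * x₃ →
      e₀₀ ≡ d₁ * x₃ * p + ȳ * x₂ + d₁ * k * x₂
    image-entry₀₀ k e₀₀ d₂≢0 h₀₀ = *-cancelˡ-≢0 d₂ d₂≢0
      (linear-combination₂ h₀₀ x̄-inverse 1ℤ (d₁ * x₃) (solve (d₁ ∷ d₂ ∷ x₂ ∷ x₃ ∷ x̄ ∷ ȳ ∷ k ∷ p ∷ e₀₀ ∷ [])))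

    entry₀₀-congruence : ∀ k e₀₀ ρ β₂ → a₀₀ - γ * a₁₀ - ȳ * x₂ - d₁ * x₃ * p ≡ ρ * d₁ → ρ - k * x₂ ≡ f * β₂ →
      e₀₀ ≡ d₁ * x₃ * p + ȳ * x₂ + d₁ * k * x₂ → a₀₀ - γ * a₁₀ - e₀₀ ≡ d₁ * f * β₂
    entry₀₀-congruence k e₀₀ ρ β₂ θ≡ρd₁ ρ≡kx₂ e₀₀≡ = linear-combination₃ θ≡ρd₁ ρ≡kx₂ e₀₀≡ 1ℤ d₁ (- 1ℤ)
      (solve (d₁ ∷ f ∷ a₀₀ ∷ a₁₀ ∷ γ ∷ ȳ ∷ x₂ ∷ x₃ ∷ p ∷ k ∷ e₀₀ ∷ ρ ∷ β₂ ∷ []))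

    entry₁₀-congruence : ∀ k e₀₀ γ₃ β₂ → (a₀₀ * a₁₁ - a₀₁ * a₁₀) - x₃ ≡ γ₃ * f →
      e₀₀ ≡ d₁ * x₃ * p + ȳ * x₂ + d₁ * k * x₂ → a₀₀ - γ * a₁₀ - e₀₀ ≡ d₁ * f * β₂ →
      d₁ * f ∣ x₂ * (a₁₀ - (d₁ * x₃ * x̄ + d₂ * ȳ + d₁ * d₂ * k))
    entry₁₀-congruence k e₀₀ γ₃ β₂ x₃≡minor₀₁ e₀₀≡ h₀₀ =
      quotient⇒∣ {d₁ * f} {x₂ * (a₁₀ - (d₁ * x₃ * x̄ + d₂ * ȳ + d₁ * d₂ * k))} (γ₃ + β₂ * d₂)
        (linear-combination₅ x₃≡minor₀₁ e₀₀≡ h₀₀ a₁₀x₂≡ x̄-inverse d₁ d₂ d₂ 1ℤ (- (d₁ * x₃))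
          (solve (d₁ ∷ d₂ ∷ f ∷ a₀₀ ∷ a₀₁ ∷ a₁₀ ∷ a₁₁ ∷ γ ∷ x₂ ∷ x₃ ∷ x̄ ∷ ȳ ∷ k ∷ p ∷ e₀₀ ∷ γ₃ ∷ β₂ ∷ [])))
      where
      a₁₀x₂≡ : a₁₀ * x₂ ≡ d₁ * (a₀₀ * a₁₁ - a₀₁ * a₁₀) + d₂ * (a₀₀ - γ * a₁₀)
      a₁₀x₂≡ = linear-combination₂ minor₁₂ x₂≡minor₀₂ a₀₀ (- a₁₀)
        (solve (d₁ ∷ d₂ ∷ a₀₀ ∷ a₀₁ ∷ a₁₀ ∷ a₁₁ ∷ w ∷ x₂ ∷ γ ∷ []))

  module Columns (a₀₀ a₁₀ γ c U : ℤ) (a₁₀≡ : a₁₀ - U ≡ c * (d₁ * f)) where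

    column₀-row₁ : a₁₀ ≡ U + c * (d₁ * f)
    column₀-row₁ = linear-combination₁ a₁₀≡ 1ℤ (solve (d₁ ∷ f ∷ a₁₀ ∷ U ∷ c ∷ []))

    column₀-row₀ : ∀ e₀₀ β₂ → a₀₀ - γ * a₁₀ - e₀₀ ≡ d₁ * f * β₂ → a₀₀ ≡ e₀₀ + γ * U + (β₂ + γ * c) * (d₁ * f)
    column₀-row₀ e₀₀ β₂ h = linear-combination₂ h a₁₀≡ 1ℤ γ
      (solve (d₁ ∷ f ∷ a₀₀ ∷ a₁₀ ∷ e₀₀ ∷ γ ∷ U ∷ c ∷ β₂ ∷ []))

    column₁-row₁ : ∀ a₁₁ w y₁ α e₁₁ → d₁ ≢ 0ℤ → w - y₁ ≡ α * d₁ → a₁₀ * w - a₁₁ * d₁ ≡ d₂ →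
      d₁ * e₁₁ ≡ U * y₁ - d₂ → a₁₁ ≡ (e₁₁ + c * (f * y₁)) + α * (U + c * (d₁ * f))
    column₁-row₁ a₁₁ w y₁ α e₁₁ d₁≢0 w≡y₁ minor₁₂ h₁₁ = *-cancelˡ-≢0 d₁ d₁≢0
      (linear-combination₄ w≡y₁ minor₁₂ a₁₀≡ h₁₁ a₁₀ (- 1ℤ) (y₁ + α * d₁) (- 1ℤ)
        (solve (d₁ ∷ d₂ ∷ f ∷ a₁₀ ∷ a₁₁ ∷ w ∷ y₁ ∷ α ∷ U ∷ c ∷ e₁₁ ∷ [])))

  column₁-row₀ : ∀ a₀₀ a₀₁ w y₁ α x₂ γ U b e₀₀ e₀₁ e₁₁ → d₁ ≢ 0ℤ →
    w - y₁ ≡ α * d₁ → (a₀₀ * w - a₀₁ * d₁) - x₂ ≡ γ * d₂ → a₀₀ ≡ e₀₀ + γ * U + b * (d₁ * f) →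
    d₁ * e₀₁ ≡ e₀₀ * y₁ - x₂ → d₁ * e₁₁ ≡ U * y₁ - d₂ →
    a₀₁ ≡ (e₀₁ + γ * e₁₁ + b * (f * y₁)) + α * (e₀₀ + γ * U + b * (d₁ * f))
  column₁-row₀ a₀₀ a₀₁ w y₁ α x₂ γ U b e₀₀ e₀₁ e₁₁ d₁≢0 w≡y₁ x₂≡minor₀₂ a₀₀≡ top-row h₁₁ = *-cancelˡ-≢0 d₁ d₁≢0
    (linear-combination₅ w≡y₁ x₂≡minor₀₂ a₀₀≡ top-row h₁₁ a₀₀ (- 1ℤ) (y₁ + α * d₁) (- 1ℤ) (- γ)
      (solve (d₁ ∷ d₂ ∷ f ∷ a₀₀ ∷ a₀₁ ∷ w ∷ y₁ ∷ α ∷ x₂ ∷ γ ∷ U ∷ b ∷ e₀₀ ∷ e₀₁ ∷ e₁₁ ∷ [])))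

  column₁-row₂ : ∀ w y₁ α → w - y₁ ≡ α * d₁ → w * f ≡ f * y₁ + α * (d₁ * f)
  column₁-row₂ w y₁ α w≡y₁ = linear-combination₁ w≡y₁ f (solve (d₁ ∷ f ∷ w ∷ y₁ ∷ α ∷ []))

module Bijection (d₁ d₂ : ℤ) (m : ℕ) (d₁≢0 : d₁ ≢ 0ℤ) (d₂≢0 : d₂ ≢ 0ℤ) (𝒳 𝒴 : ℤ → Set)
  (𝒳-reps : CompleteReducedReps d₂ (d₁ * d₂ * + suc m) 𝒳)
  (𝒴-reps : CompleteReducedReps d₁ (d₁ * d₂ * + suc m) 𝒴)
  (xbar ybar : ℤ → ℤ)
  (xbar-inverse : ∀ x₂ → 𝒳 x₂ → d₂ ∣ (x₂ * xbar x₂ - 1ℤ))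
  (ybar-inverse : ∀ y₁ → 𝒴 y₁ → d₁ ∣ (y₁ * ybar y₁ - 1ℤ)) where

  f : ℤ
  f = + suc m

  f≢0 : f ≢ 0ℤ
  f≢0 ()

  𝒴-coprime : ∀ {y} → 𝒴 y → Coprime y d₁
  𝒴-coprime {y} y∈𝒴 = coprime-∣ʳ {y} {d₁ * d₂ * f} {d₁} (proj₁ 𝒴-reps _ y∈𝒴) (proj₁ (∣-factors d₁ d₂ f))

  𝒴-unique : ∀ {y y' q} → 𝒴 y → 𝒴 y' → y' - y ≡ q * d₁ → y' ≡ y
  𝒴-unique {q = q} y∈𝒴 y'∈𝒴 e = proj₂ (proj₂ 𝒴-reps) _ _ y'∈𝒴 y∈𝒴 (quotient⇒∣ {d₁} q e)

  𝒳-unique : ∀ {x x' q} → 𝒳 x → 𝒳 x' → x' - x ≡ q * d₂ → x' ≡ x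
  𝒳-unique {q = q} x∈𝒳 x'∈𝒳 e = proj₂ (proj₂ 𝒳-reps) _ _ x'∈𝒳 x∈𝒳 (quotient⇒∣ {d₂} q e)

  IsImageOf : Params → Mat3 → Set
  IsImageOf = IsImage d₁ d₂ f xbar ybar

  image-InΩ : ∀ t M → InDomain d₁ d₂ f 𝒳 𝒴 t → IsImageOf t M → InΩ d₁ d₂ f M
  image-InΩ (x₂ , y₁ , x₃ , y₃ , k) M (_ , y₁∈𝒴 , _) img@(_ , _ , _ , _ , _ , _ , h₂₀ , h₂₁ , _) =
    image-det d₁≢0 d₂≢0 {M} img ,
    trans (cong₂ gcd h₂₀ h₂₁) (gcd[d*n,n*y]≡n m {d₁} {y₁} (𝒴-coprime y₁∈𝒴)) ,
    h₂₀ ,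
    image-minor {M} img
    where open ImageMatrix d₁ d₂ f x₂ y₁ x₃ y₃ k (xbar x₂) (ybar y₁)

  image-exists : ∀ t → InDomain d₁ d₂ f 𝒳 𝒴 t → ∃ λ M → IsImageOf t M × InΩ d₁ d₂ f M
  image-exists t@(x₂ , y₁ , x₃ , y₃ , k) t∈@(x₂∈𝒳 , y₁∈𝒴 , (_ , _ , f∣x₃y₃-1) , _) =
    imageMatrix , imageMatrix-isImage , image-InΩ t imageMatrix t∈ imageMatrix-isImage
    where
    open ImageMatrix d₁ d₂ f x₂ y₁ x₃ y₃ k (xbar x₂) (ybar y₁)
    p : ∃ λ p → x₂ * xbar x₂ - 1ℤ ≡ p * d₂
    p = ∣⇒∃-quotient {d₂} {x₂ * xbar x₂ - 1ℤ} (xbar-inverse x₂ x₂∈𝒳)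
    q : ∃ λ q → y₁ * ybar y₁ - 1ℤ ≡ q * d₁
    q = ∣⇒∃-quotient {d₁} {y₁ * ybar y₁ - 1ℤ} (ybar-inverse y₁ y₁∈𝒴)
    r : ∃ λ r → x₃ * y₃ - 1ℤ ≡ r * f
    r = ∣⇒∃-quotient {f} {x₃ * y₃ - 1ℤ} f∣x₃y₃-1
    open Construction (proj₁ p) (proj₁ q) (proj₁ r) (proj₂ p) (proj₂ q) (proj₂ r)

  open InjectivityAlgebra d₁ d₂ f d₁≢0 d₂≢0 f≢0

  y₁-determined : ∀ y₁ y₁' a' → 𝒴 y₁ → 𝒴 y₁' → f * y₁' ≡ f * y₁ + a' * (d₁ * f) →
    y₁' ≡ y₁ × a' ≡ 0ℤ
  y₁-determined y₁ y₁' a' y₁∈𝒴 y₁'∈𝒴 h = y₁'≡y₁ , ≡⇒quotient≡0 {q = a'} d₁≢0 y₁'≡y₁ congruence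
    where
    congruence : y₁' - y₁ ≡ a' * d₁
    congruence = y₁-congruence y₁ y₁' a' h
    y₁'≡y₁ : y₁' ≡ y₁
    y₁'≡y₁ = 𝒴-unique {q = a'} y₁∈𝒴 y₁'∈𝒴 congruence

  y₃-determined : ∀ y₁ y₃ y₃' b' c' → InUpperWindow f y₃ → InUpperWindow f y₃' →
    y₃' ≡ y₃ + b' * (d₁ * f) + c' * (f * y₁) → y₃' ≡ y₃ × b' * d₁ + c' * y₁ ≡ 0ℤ
  y₃-determined y₁ y₃ y₃' b' c' y₃∈ y₃'∈ h = y₃'≡y₃ , ≡⇒quotient≡0 {q = b' * d₁ + c' * y₁} f≢0 y₃'≡y₃ congruence
    where
    congruence : y₃' - y₃ ≡ (b' * d₁ + c' * y₁) * f
    congruence = y₃-congruence y₁ y₃ y₃' b' c' h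
    y₃'≡y₃ : y₃' ≡ y₃
    y₃'≡y₃ = InUpperWindow-congruent⇒≡ m {q = b' * d₁ + c' * y₁} y₃'∈ y₃∈ congruence

  x₂-determined : ∀ y₁ y₁' x₂ x₂' a b a' u e₀₀ e₀₁ e₁₁ g₀₀ g₀₁ → 𝒳 x₂ → 𝒳 x₂' → y₁' ≡ y₁ →
    d₁ * g₀₁ ≡ g₀₀ * y₁' - x₂' → d₁ * e₀₁ ≡ e₀₀ * y₁ - x₂ → d₁ * e₁₁ ≡ u * y₁ - d₂ →
    g₀₀ ≡ e₀₀ + a * u + b * (d₁ * f) →
    g₀₁ ≡ (e₀₁ + a * e₁₁ + b * (f * y₁)) + a' * (e₀₀ + a * u + b * (d₁ * f)) → a' ≡ 0ℤ →
    x₂' ≡ x₂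
  x₂-determined y₁ _ x₂ x₂' a b a' u e₀₀ e₀₁ e₁₁ g₀₀ g₀₁ x₂∈𝒳 x₂'∈𝒳 refl top-row′ top-row h₁₁ coset₀₀ coset₀₁ a'≡0 =
    𝒳-unique {q = a} x₂∈𝒳 x₂'∈𝒳
      (x₂-congruence y₁ x₂ x₂' a b a' u e₀₀ e₀₁ e₁₁ g₀₀ g₀₁ top-row′ top-row h₁₁ coset₀₀ coset₀₁ a'≡0)

  x₃-determined : ∀ x₃ x₃' y₃ y₃' → InUpperWindow f x₃ → InUpperWindow f x₃' → y₃' ≡ y₃ →
    f ∣ x₃ * y₃ - 1ℤ → f ∣ x₃' * y₃' - 1ℤ → x₃' ≡ x₃
  x₃-determined x₃ x₃' y₃ _ x₃∈ x₃'∈ refl f∣x₃y₃-1 f∣x₃'y₃-1 =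
    InUpperWindow-congruent⇒≡ m {q = x₃ * proj₁ r' - x₃' * proj₁ r} x₃'∈ x₃∈
      (x₃-congruence x₃ x₃' y₃ (proj₁ r) (proj₁ r') (proj₂ r) (proj₂ r'))
    where
    r : ∃ λ r → x₃ * y₃ - 1ℤ ≡ r * f
    r = ∣⇒∃-quotient {f} {x₃ * y₃ - 1ℤ} f∣x₃y₃-1
    r' : ∃ λ r → x₃' * y₃ - 1ℤ ≡ r * f
    r' = ∣⇒∃-quotient {f} {x₃' * y₃ - 1ℤ} f∣x₃'y₃-1

  k-determined : ∀ y₁ x₃ x₃' y₃ y₃' x̄ x̄' ȳ ȳ' k k' c b' c' e₁₁ e₁₂ g₁₂ →
    x₃' ≡ x₃ → y₃' ≡ y₃ → x̄' ≡ x̄ → ȳ' ≡ ȳ → 𝒴 y₁ → InK f k → InK f k' →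
    f ∣ x₃ * y₃ - 1ℤ → b' * d₁ + c' * y₁ ≡ 0ℤ →
    let u  = d₁ * x₃ * x̄ + d₂ * ȳ + d₁ * d₂ * k
        v  = d₂ * ȳ * y₃ + d₁ * x̄ + d₁ * d₂ * y₃ * k
        u' = d₁ * x₃' * x̄' + d₂ * ȳ' + d₁ * d₂ * k'
        v' = d₂ * ȳ' * y₃' + d₁ * x̄' + d₁ * d₂ * y₃' * k' in
    d₁ * e₁₁ ≡ u * y₁ - d₂ → d₁ * f * e₁₂ ≡ u * y₃ - v → d₁ * f * g₁₂ ≡ u' * y₃' - v' →
    u' ≡ u + c * (d₁ * f) → g₁₂ ≡ (e₁₂ + c * y₃) + b' * (u + c * (d₁ * f)) + c' * (e₁₁ + c * (f * y₁)) →
    k' ≡ k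
  k-determined y₁ x₃ _ y₃ _ x̄ _ ȳ _ k k' c b' c' e₁₁ e₁₂ g₁₂ refl refl refl refl
               y₁∈𝒴 k∈ k'∈ f∣x₃y₃-1 b'd₁+c'y₁≡0 h₁₁ h₁₂ h₁₂′ coset₁₀ coset₁₂ =
    InK-congruent⇒≡ m {q = x₃ * proj₁ τ - proj₁ r * (k' - k)} k'∈ k∈
      (k-congruence (k' - k) x₃ y₃ (proj₁ r) c c' (proj₁ τ)
        (k-difference x₃ y₃ x̄ ȳ k k' c coset₁₀) c-rel (proj₂ τ) (proj₂ r))
    where
    r : ∃ λ r → x₃ * y₃ - 1ℤ ≡ r * f
    r = ∣⇒∃-quotient {f} {x₃ * y₃ - 1ℤ} f∣x₃y₃-1
    τ : ∃ λ τ → c' ≡ τ * d₁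
    τ = c'-multiple-of-d₁ y₁ b' c' (𝒴-coprime y₁∈𝒴) b'd₁+c'y₁≡0
    c-rel : c * y₃ * d₁ ≡ c' * d₂
    c-rel = c-relation y₁ y₃ (d₁ * x₃ * x̄ + d₂ * ȳ + d₁ * d₂ * k) c b' c' e₁₁ e₁₂ g₁₂ coset₁₂
              (entry₁₂-independent-of-k x₃ y₃ x̄ ȳ k k' e₁₂ g₁₂ h₁₂′ h₁₂) b'd₁+c'y₁≡0 h₁₁

  Params-≡ : ∀ {x₂ y₁ x₃ y₃ k x₂' y₁' x₃' y₃' k'} → x₂ ≡ x₂' → y₁ ≡ y₁' → x₃ ≡ x₃' → y₃ ≡ y₃' → k ≡ k' →
    _≡_ {A = Params} (x₂ , y₁ , x₃ , y₃ , k) (x₂' , y₁' , x₃' , y₃' , k')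
  Params-≡ refl refl refl refl refl = refl

  -- Stated for a matrix of variable entries, so that the entries fixed by IsImage can be
  -- substituted by matching on refl; any M is definitionally such a matrix at each entry.
  private
    injective-on-entries : ∀ {t t'} → InDomain d₁ d₂ f 𝒳 𝒴 t → InDomain d₁ d₂ f 𝒳 𝒴 t' →
      ∀ e₀₀ e₀₁ e₀₂ e₁₀ e₁₁ e₁₂ e₂₀ e₂₁ e₂₂ g₀₀ g₀₁ g₀₂ g₁₀ g₁₁ g₁₂ g₂₀ g₂₁ g₂₂ a b c a' b' c' →
      IsImageOf t (matrix e₀₀ e₀₁ e₀₂ e₁₀ e₁₁ e₁₂ e₂₀ e₂₁ e₂₂) →
      IsImageOf t' (matrix g₀₀ g₀₁ g₀₂ g₁₀ g₁₁ g₁₂ g₂₀ g₂₁ g₂₂) →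
      matrix g₀₀ g₀₁ g₀₂ g₁₀ g₁₁ g₁₂ g₂₀ g₂₁ g₂₂
        ≋ addColumns a' b' c' (addRows a b c (matrix e₀₀ e₀₁ e₀₂ e₁₀ e₁₁ e₁₂ e₂₀ e₂₁ e₂₂)) →
      t ≡ t'
    injective-on-entries {x₂ , y₁ , x₃ , y₃ , k} {x₂' , y₁' , x₃' , y₃' , k'}
      (x₂∈𝒳 , y₁∈𝒴 , (x₃∈ , y₃∈ , f∣x₃y₃-1) , k∈) (x₂'∈𝒳 , y₁'∈𝒴 , (x₃'∈ , y₃'∈ , f∣x₃'y₃'-1) , k'∈)
      e₀₀ e₀₁ e₀₂ _ e₁₁ e₁₂ _ _ _ g₀₀ g₀₁ g₀₂ _ g₁₁ g₁₂ _ _ _ a b c a' b' c'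
      (h₀₀ , h₀₁ , _ , refl , h₁₁ , h₁₂ , refl , refl , refl)
      (h₀₀′ , h₀₁′ , _ , refl , _ , h₁₂′ , refl , refl , refl) coset =
      Params-≡ (sym x₂'≡x₂) (sym y₁'≡y₁) (sym x₃'≡x₃) (sym y₃'≡y₃) (sym k'≡k)
      where
      bottom-middle : y₁' ≡ y₁ × a' ≡ 0ℤ
      bottom-middle = y₁-determined y₁ y₁' a' y₁∈𝒴 y₁'∈𝒴 (coset i2 i1)
      bottom-right : y₃' ≡ y₃ × b' * d₁ + c' * y₁ ≡ 0ℤ
      bottom-right = y₃-determined y₁ y₃ y₃' b' c' y₃∈ y₃'∈ (coset i2 i2)
      y₁'≡y₁ : y₁' ≡ y₁
      y₁'≡y₁ = proj₁ bottom-middle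
      y₃'≡y₃ : y₃' ≡ y₃
      y₃'≡y₃ = proj₁ bottom-right
      x₂'≡x₂ : x₂' ≡ x₂
      x₂'≡x₂ = x₂-determined y₁ y₁' x₂ x₂' a b a' (d₁ * x₃ * xbar x₂ + d₂ * ybar y₁ + d₁ * d₂ * k)
        e₀₀ e₀₁ e₁₁ g₀₀ g₀₁ x₂∈𝒳 x₂'∈𝒳 y₁'≡y₁
        (ImageMatrix.top-row-relation d₁ d₂ f x₂' y₁' x₃' y₃' k' (xbar x₂') (ybar y₁') d₁≢0 d₂≢0 g₀₀ g₀₁ h₀₀′ h₀₁′)
        (ImageMatrix.top-row-relation d₁ d₂ f x₂ y₁ x₃ y₃ k (xbar x₂) (ybar y₁) d₁≢0 d₂≢0 e₀₀ e₀₁ h₀₀ h₀₁)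
        h₁₁ (coset i0 i0) (coset i0 i1) (proj₂ bottom-middle)
      x₃'≡x₃ : x₃' ≡ x₃
      x₃'≡x₃ = x₃-determined x₃ x₃' y₃ y₃' x₃∈ x₃'∈ y₃'≡y₃ f∣x₃y₃-1 f∣x₃'y₃'-1
      k'≡k : k' ≡ k
      k'≡k = k-determined y₁ x₃ x₃' y₃ y₃' (xbar x₂) (xbar x₂') (ybar y₁) (ybar y₁') k k' c b' c' e₁₁ e₁₂ g₁₂
        x₃'≡x₃ y₃'≡y₃ (cong xbar x₂'≡x₂) (cong ybar y₁'≡y₁) y₁∈𝒴 k∈ k'∈ f∣x₃y₃-1 (proj₂ bottom-right)
        h₁₁ h₁₂ h₁₂′ (coset i1 i0) (coset i1 i2)

  injective : ∀ t t' M M' → InDomain d₁ d₂ f 𝒳 𝒴 t → InDomain d₁ d₂ f 𝒳 𝒴 t' →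
    IsImageOf t M → IsImageOf t' M' → SameDoubleCoset M M' → t ≡ t'
  injective t t' M M' t∈ t'∈ img img' (a , b , c , a' , b' , c' , M'≋) =
    injective-on-entries t∈ t'∈
      (M i0 i0) (M i0 i1) (M i0 i2) (M i1 i0) (M i1 i1) (M i1 i2) (M i2 i0) (M i2 i1) (M i2 i2)
      (M' i0 i0) (M' i0 i1) (M' i0 i2) (M' i1 i0) (M' i1 i1) (M' i1 i2) (M' i2 i0) (M' i2 i1) (M' i2 i2)
      a b c a' b' c' img img'
      λ { i0 i0 → coset i0 i0 ; i0 i1 → coset i0 i1 ; i0 i2 → coset i0 i2
        ; i1 i0 → coset i1 i0 ; i1 i1 → coset i1 i1 ; i1 i2 → coset i1 i2
        ; i2 i0 → coset i2 i0 ; i2 i1 → coset i2 i1 ; i2 i2 → coset i2 i2 }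
    where
    coset : M' ≋ addColumns a' b' c' (addRows a b c M)
    coset = ≋-trans M'≋ (unip-⊗-⊗-unip a b c M a' b' c')

  open SurjectivityAlgebra d₁ d₂ f

  module ReducedForm {A : Mat3} (A∈Ω : InΩ d₁ d₂ f A) where

    a₀₀ a₀₁ a₀₂ a₁₀ a₁₁ a₁₂ a₂₁ a₂₂ : ℤ
    a₀₀ = A i0 i0
    a₀₁ = A i0 i1
    a₀₂ = A i0 i2
    a₁₀ = A i1 i0
    a₁₁ = A i1 i1
    a₁₂ = A i1 i2
    a₂₁ = A i2 i1
    a₂₂ = A i2 i2

    a₂₀≡ : A i2 i0 ≡ d₁ * f
    a₂₀≡ = proj₁ (proj₂ (proj₂ A∈Ω))

    w-quotient : ∃ λ w → a₂₁ ≡ w * f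
    w-quotient = ∣⇒∃-quotient {f} {a₂₁} (subst (_∣ a₂₁) (proj₁ (proj₂ A∈Ω)) (gcd[i,j]∣j (A i2 i0) a₂₁))

    w : ℤ
    w = proj₁ w-quotient

    a₂₁≡wf : a₂₁ ≡ w * f
    a₂₁≡wf = proj₂ w-quotient

    w⊥d₁ : Coprime w d₁
    w⊥d₁ = gcd[d*n,w*n]≡n⇒coprime m {d₁} {w} (trans (cong₂ gcd (sym a₂₀≡) (sym a₂₁≡wf)) (proj₁ (proj₂ A∈Ω)))

    minor₁₂ : a₁₀ * w - a₁₁ * d₁ ≡ d₂
    minor₁₂ = reduced-minor₁₂ w a₁₀ a₁₁ f≢0
      (trans (cong₂ (λ x y → a₁₀ * x - a₁₁ * y) (sym a₂₁≡wf) (sym a₂₀≡)) (proj₂ (proj₂ (proj₂ A∈Ω))))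

    reduced-det : a₀₀ * (a₁₁ * a₂₂ - a₁₂ * (w * f)) - a₀₁ * (a₁₀ * a₂₂ - a₁₂ * (d₁ * f))
                  + a₀₂ * (a₁₀ * (w * f) - a₁₁ * (d₁ * f)) ≡ 1ℤ
    reduced-det = trans (sym (det3-cong A≋)) (proj₁ A∈Ω)
      where
      A≋ : A ≋ matrix a₀₀ a₀₁ a₀₂ a₁₀ a₁₁ a₁₂ (d₁ * f) (w * f) a₂₂
      A≋ = λ { i0 i0 → refl ; i0 i1 → refl ; i0 i2 → refl ; i1 i0 → refl ; i1 i1 → refl ; i1 i2 → refl
             ; i2 i0 → a₂₀≡ ; i2 i1 → a₂₁≡wf ; i2 i2 → refl }

    y₁-residue : ∃ λ y → 𝒴 y × d₁ ∣ (w - y)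
    y₁-residue = proj₁ (proj₂ 𝒴-reps) w w⊥d₁

    y₁ α : ℤ
    y₁ = proj₁ y₁-residue
    α  = proj₁ (∣⇒∃-quotient {d₁} {w - y₁} (proj₂ (proj₂ y₁-residue)))

    w≡y₁ : w - y₁ ≡ α * d₁
    w≡y₁ = proj₂ (∣⇒∃-quotient {d₁} {w - y₁} (proj₂ (proj₂ y₁-residue)))

    y₃-residue : ∃ λ y → InUpperWindow f y × ∃ λ q → a₂₂ - y ≡ q * f
    y₃-residue = InUpperWindow-residue m a₂₂

    y₃ β : ℤ
    y₃ = proj₁ y₃-residue
    β  = proj₁ (proj₂ (proj₂ y₃-residue))

    minor₀₂ : ℤ
    minor₀₂ = a₀₀ * w - a₀₁ * d₁

    x₂-residue : ∃ λ x → 𝒳 x × d₂ ∣ (minor₀₂ - x)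
    x₂-residue = proj₁ (proj₂ 𝒳-reps) minor₀₂ (reduced-minor₀₂⊥d₂ w a₀₀ a₀₁ a₀₂ a₁₀ a₁₁ a₁₂ a₂₂ reduced-det w⊥d₁ minor₁₂)

    x₂ γ : ℤ
    x₂ = proj₁ x₂-residue
    γ  = proj₁ (∣⇒∃-quotient {d₂} {minor₀₂ - x₂} (proj₂ (proj₂ x₂-residue)))

    x₂≡minor₀₂ : minor₀₂ - x₂ ≡ γ * d₂
    x₂≡minor₀₂ = proj₂ (∣⇒∃-quotient {d₂} {minor₀₂ - x₂} (proj₂ (proj₂ x₂-residue)))

    x₃-residue : ∃ λ x → InUpperWindow f x × ∃ λ q → (a₀₀ * a₁₁ - a₀₁ * a₁₀) - x ≡ q * f
    x₃-residue = InUpperWindow-residue m (a₀₀ * a₁₁ - a₀₁ * a₁₀)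

    x₃ γ₃ : ℤ
    x₃ = proj₁ x₃-residue
    γ₃ = proj₁ (proj₂ (proj₂ x₃-residue))

    f∣x₃y₃-1 : f ∣ x₃ * y₃ - 1ℤ
    f∣x₃y₃-1 = minor₀₁-inverts-a₂₂ w a₀₀ a₀₁ a₀₂ a₁₀ a₁₁ a₁₂ a₂₂ reduced-det x₃ y₃ γ₃ β
                 (proj₂ (proj₂ (proj₂ x₃-residue))) (proj₂ (proj₂ (proj₂ y₃-residue)))

  module Preimage {A : Mat3} (A∈Ω : InΩ d₁ d₂ f A) where

    open ReducedForm {A} A∈Ω

    x̄ ȳ : ℤ
    x̄ = xbar x₂
    ȳ = ybar y₁

    p-quotient : ∃ λ p → x₂ * x̄ - 1ℤ ≡ p * d₂
    p-quotient = ∣⇒∃-quotient {d₂} {x₂ * x̄ - 1ℤ} (xbar-inverse x₂ (proj₁ (proj₂ x₂-residue)))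

    p : ℤ
    p = proj₁ p-quotient

    open TopLeftCongruences a₀₀ a₀₁ a₁₀ a₁₁ w y₁ α x₂ γ x₃ x̄ ȳ p w≡y₁ minor₁₂ x₂≡minor₀₂ (proj₂ p-quotient)

    θ : ℤ
    θ = a₀₀ - γ * a₁₀ - ȳ * x₂ - d₁ * x₃ * p

    ρ-quotient : ∃ λ ρ → θ ≡ ρ * d₁
    ρ-quotient = ∣⇒∃-quotient {d₁} {θ}
      (coprime-divisor d₁ y₁ θ (Coprime.sym {y₁} {d₁} (𝒴-coprime (proj₁ (proj₂ y₁-residue))))
        (d₁∣y₁θ (proj₁ q) (proj₂ q)))
      where
      q : ∃ λ q → y₁ * ȳ - 1ℤ ≡ q * d₁
      q = ∣⇒∃-quotient {d₁} {y₁ * ȳ - 1ℤ} (ybar-inverse y₁ (proj₁ (proj₂ y₁-residue)))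

    ρ : ℤ
    ρ = proj₁ ρ-quotient

    -- k is ρ / x₂ modulo f
    x₂-bézout : ∃₂ λ s t → s * x₂ + t * f ≡ 1ℤ
    x₂-bézout = bézout {x₂} {f}
      (coprime-∣ʳ {x₂} {d₁ * d₂ * f} {f} (proj₁ 𝒳-reps x₂ (proj₁ (proj₂ x₂-residue))) (proj₂ (proj₂ (∣-factors d₁ d₂ f))))

    k-residue : ∃ λ k → InK f k × ∃ λ q → ρ * proj₁ x₂-bézout - k ≡ q * f
    k-residue = InK-residue m (ρ * proj₁ x₂-bézout)

    k β₂ : ℤ
    k  = proj₁ k-residue
    β₂ = ρ * proj₁ (proj₂ x₂-bézout) + proj₁ (proj₂ (proj₂ k-residue)) * x₂

    ρ≡kx₂ : ρ - k * x₂ ≡ f * β₂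
    ρ≡kx₂ = residue-of-quotient ρ k x₂ (proj₁ x₂-bézout) (proj₁ (proj₂ x₂-bézout)) (proj₁ (proj₂ (proj₂ k-residue)))
              (proj₂ (proj₂ (proj₂ k-residue))) (proj₂ (proj₂ x₂-bézout))

    E₀₀ U : ℤ
    E₀₀ = d₁ * x₃ * p + ȳ * x₂ + d₁ * k * x₂
    U   = d₁ * x₃ * x̄ + d₂ * ȳ + d₁ * d₂ * k

    a₀₀≡E₀₀ : a₀₀ - γ * a₁₀ - E₀₀ ≡ d₁ * f * β₂
    a₀₀≡E₀₀ = entry₀₀-congruence k E₀₀ ρ β₂ (proj₂ ρ-quotient) ρ≡kx₂ refl

    c-quotient : ∃ λ c → a₁₀ - U ≡ c * (d₁ * f)
    c-quotient = ∣⇒∃-quotient {d₁ * f} {a₁₀ - U}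
      (coprime-divisor (d₁ * f) x₂ (a₁₀ - U) d₁f⊥x₂
        (entry₁₀-congruence k E₀₀ γ₃ β₂ (proj₂ (proj₂ (proj₂ x₃-residue))) refl a₀₀≡E₀₀))
      where
      d₁f⊥x₂ : Coprime (d₁ * f) x₂
      d₁f⊥x₂ = Coprime.sym {x₂} {d₁ * f}
        (coprime-∣ʳ {x₂} {d₁ * d₂ * f} {d₁ * f} (proj₁ 𝒳-reps x₂ (proj₁ (proj₂ x₂-residue))) (proj₁ (proj₂ (∣-factors d₁ d₂ f))))

    c b : ℤ
    c = proj₁ c-quotient
    b = β₂ + γ * c

    t : Params
    t = x₂ , y₁ , x₃ , y₃ , k

    t∈ : InDomain d₁ d₂ f 𝒳 𝒴 t
    t∈ = proj₁ (proj₂ x₂-residue) , proj₁ (proj₂ y₁-residue) ,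
         (proj₁ (proj₂ x₃-residue) , proj₁ (proj₂ y₃-residue) , f∣x₃y₃-1) , proj₁ (proj₂ k-residue)

    open Columns a₀₀ a₁₀ γ c U (proj₂ c-quotient)

    coset-of-image : ∀ e₀₀ e₀₁ e₀₂ e₁₀ e₁₁ e₁₂ e₂₀ e₂₁ e₂₂ →
      IsImageOf t (matrix e₀₀ e₀₁ e₀₂ e₁₀ e₁₁ e₁₂ e₂₀ e₂₁ e₂₂) →
      SameDoubleCoset (matrix e₀₀ e₀₁ e₀₂ e₁₀ e₁₁ e₁₂ e₂₀ e₂₁ e₂₂) A
    coset-of-image e₀₀ e₀₁ e₀₂ _ e₁₁ e₁₂ _ _ e₂₂ img@(h₀₀ , h₀₁ , _ , refl , h₁₁ , _ , refl , refl , _) =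
      sameDoubleCoset-from-columns₀₁ {M} {A} γ b c α
        (ImageMatrix.image-det d₁ d₂ f x₂ y₁ x₃ y₃ k x̄ ȳ d₁≢0 d₂≢0 {M} img) (proj₁ A∈Ω) column₀ column₁
      where
      M : Mat3
      M = matrix e₀₀ e₀₁ e₀₂ U e₁₁ e₁₂ (d₁ * f) (f * y₁) e₂₂
      e₀₀≡E₀₀ : e₀₀ ≡ E₀₀
      e₀₀≡E₀₀ = image-entry₀₀ k e₀₀ d₂≢0 h₀₀
      column₀ : ∀ i → A i i0 ≡ addColumns α 0ℤ 0ℤ (addRows γ b c M) i i0
      column₀ i0 = trans (column₀-row₀ E₀₀ β₂ a₀₀≡E₀₀) (cong (λ x → x + γ * U + b * (d₁ * f)) (sym e₀₀≡E₀₀))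
      column₀ i1 = column₀-row₁
      column₀ i2 = a₂₀≡
      column₁ : ∀ i → A i i1 ≡ addColumns α 0ℤ 0ℤ (addRows γ b c M) i i1
      column₁ i0 = column₁-row₀ a₀₀ a₀₁ w y₁ α x₂ γ U b e₀₀ e₀₁ e₁₁ d₁≢0 w≡y₁ x₂≡minor₀₂ (column₀ i0)
        (ImageMatrix.top-row-relation d₁ d₂ f x₂ y₁ x₃ y₃ k x̄ ȳ d₁≢0 d₂≢0 e₀₀ e₀₁ h₀₀ h₀₁) h₁₁
      column₁ i1 = column₁-row₁ a₁₁ w y₁ α e₁₁ d₁≢0 w≡y₁ minor₁₂ h₁₁
      column₁ i2 = trans a₂₁≡wf (column₁-row₂ w y₁ α w≡y₁)

  surjective : ∀ A → InΩ d₁ d₂ f A →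
    ∃ λ t → ∃ λ M → InDomain d₁ d₂ f 𝒳 𝒴 t × IsImageOf t M × SameDoubleCoset M A
  surjective A A∈Ω =
    t , M , t∈ , img ,
    coset-of-image (M i0 i0) (M i0 i1) (M i0 i2) (M i1 i0) (M i1 i1) (M i1 i2) (M i2 i0) (M i2 i1) (M i2 i2) img
    where
    open Preimage {A} A∈Ω
    M : Mat3
    M = proj₁ (image-exists t t∈)
    img : IsImageOf t M
    img = proj₁ (proj₂ (image-exists t t∈))

corollary5p8 :
  (d₁ d₂ f : ℤ) → d₁ ≢ 0ℤ → d₂ ≢ 0ℤ → 0ℤ < f →
  (𝒳 𝒴 : ℤ → Set) →
  CompleteReducedReps d₂ (d₁ * d₂ * f) 𝒳 →
  CompleteReducedReps d₁ (d₁ * d₂ * f) 𝒴 →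
  (xbar ybar : ℤ → ℤ) →
  (∀ x₂ → 𝒳 x₂ → d₂ ∣ (x₂ * xbar x₂ - 1ℤ)) →
  (∀ y₁ → 𝒴 y₁ → d₁ ∣ (y₁ * ybar y₁ - 1ℤ)) →
  -- well-defined, with values in Γ∞\Ω(d₁,d₂,f)/Γ∞
  ((t : Params) → InDomain d₁ d₂ f 𝒳 𝒴 t →
    ∃ λ M → IsImage d₁ d₂ f xbar ybar t M × InΩ d₁ d₂ f M)
  -- injective on double cosets
  × ((t t' : Params) (M M' : Mat3) →
    InDomain d₁ d₂ f 𝒳 𝒴 t → InDomain d₁ d₂ f 𝒳 𝒴 t' →
    IsImage d₁ d₂ f xbar ybar t M → IsImage d₁ d₂ f xbar ybar t' M' →
    SameDoubleCoset M M' → t ≡ t')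
  -- surjective onto Γ∞\Ω(d₁,d₂,f)/Γ∞
  × ((A : Mat3) → InΩ d₁ d₂ f A →
    ∃ λ t → ∃ λ M → InDomain d₁ d₂ f 𝒳 𝒴 t ×
      IsImage d₁ d₂ f xbar ybar t M × SameDoubleCoset M A)
corollary5p8 d₁ d₂ (+ zero)    _ _ (+<+ ()) _ _ _ _ _ _ _ _
corollary5p8 d₁ d₂ -[1+ _ ]    _ _ ()       _ _ _ _ _ _ _ _
corollary5p8 d₁ d₂ (+ suc m) d₁≢0 d₂≢0 _ 𝒳 𝒴 𝒳-reps 𝒴-reps xbar ybar xbar-inverse ybar-inverse =
  image-exists , injective , surjective
  where open Bijection d₁ d₂ m d₁≢0 d₂≢0 𝒳 𝒴 𝒳-reps 𝒴-reps xbar ybar xbar-inverse ybar-inverse
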